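{- For a positive integer $n$, let $\mathcal{A}_n^+\subseteq\mathfrak{S}_n$ be the set of even permutations and $\mathcal{A}_n^-$ the set of odd permutations. For $\pi=\pi_1\cdots\pi_n\in\mathfrak{S}_n$ let $\mathrm{exc}(\pi)=|\{i\in[n-1]:\pi_i>i\}|$, and let $\mathrm{AE}_n^{\pm}(t)=\sum_{\pi\in\mathcal{A}_n^{\pm}}t^{\mathrm{exc}(\pi)}$. Then, as formal power series, $$\frac{\mathrm{AE}_n^{\pm}(t)}{(1-t)^{n+1}}=\sum_{k\ge 0}\frac{(k+1)^n\pm(k+1)}{2}\,t^k,$$ with the same choice of sign on both sides. -}

module Defs where

open import Data.Nat as ℕ using (ℕ; zero; suc; _∸_; _<?_; _≟_)
open import Data.Nat.DivMod using (_/_)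
open import Data.Fin using (Fin; toℕ)
open import Data.Fin.Properties using (all?) renaming (_≟_ to _≟ᶠ_)
open import Data.Vec using (Vec; []; _∷_; lookup)
open import Data.List using (List; []; _∷_; [_]; map; concatMap; filter; length; allFin; cartesianProduct)
open import Data.Product using (_×_; _,_; proj₁; proj₂)
open import Data.Integer as ℤ using (ℤ; +_; -_)
open import Relation.Binary.PropositionalEquality using (_≡_)
open import Relation.Nullary.Decidable using (Dec; ¬?; _→-dec_; _×-dec_)

-- A permutation of [n] is represented in one-line notation π₁⋯πₙ as a
-- vector of length n over Fin n (values shifted down by one, 0-indexed)
-- whose entries are pairwise distinct (i.e. the map i ↦ πᵢ is injective).

words : (n m : ℕ) → List (Vec (Fin n) m)
words n zero    = [ [] ]
words n (suc m) = concatMap (λ w → map (_∷ w) (allFin n)) (words n m)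

IsPerm : ∀ {n} → Vec (Fin n) n → Set
IsPerm {n} v = ∀ (i j : Fin n) → lookup v i ≡ lookup v j → i ≡ j

isPerm? : ∀ {n} (v : Vec (Fin n) n) → Dec (IsPerm v)
isPerm? v = all? λ i → all? λ j → (lookup v i ≟ᶠ lookup v j) →-dec (i ≟ᶠ j)

perms : (n : ℕ) → List (Vec (Fin n) n)
perms n = filter isPerm? (words n n)

inv : ∀ {n} → Vec (Fin n) n → ℕ
inv {n} v = length (filter (λ p → (toℕ (proj₁ p) <? toℕ (proj₂ p))
                             ×-dec (toℕ (lookup v (proj₂ p)) <? toℕ (lookup v (proj₁ p))))
                     (cartesianProduct (allFin n) (allFin n)))

IsEven : ∀ {n} → Vec (Fin n) n → Set
IsEven v = inv v ℕ.% 2 ≡ 0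

even? : ∀ {n} (v : Vec (Fin n) n) → Dec (IsEven v)
even? v = (inv v ℕ.% 2) ≟ 0

evenPerms oddPerms : (n : ℕ) → List (Vec (Fin n) n)
evenPerms n = filter even? (perms n)
oddPerms  n = filter (λ v → ¬? (even? v)) (perms n)

-- exc(π) = |{ i ∈ [n-1] : πᵢ > i }|  (1-indexed i ∈ {1,…,n-1};
-- here 0-indexed i with i+1 < n, and πᵢ > i compared after the same shift)
exc : ∀ {n} → Vec (Fin n) n → ℕ
exc {n} v = length (filter (λ i → (suc (toℕ i) <? n) ×-dec (toℕ i <? toℕ (lookup v i))) (allFin n))

Series : Set
Series = ℕ → ℤ

sumTo : ℕ → (ℕ → ℤ) → ℤ
sumTo zero    f = f 0
sumTo (suc m) f = sumTo m f ℤ.+ f (suc m)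

_⊛_ : Series → Series → Series
(f ⊛ g) m = sumTo m (λ j → f j ℤ.* g (m ∸ j))

oneS : Series
oneS zero    = + 1
oneS (suc _) = + 0

oneMinusT : Series
oneMinusT zero          = + 1
oneMinusT (suc zero)    = - (+ 1)
oneMinusT (suc (suc _)) = + 0

_^S_ : Series → ℕ → Series
f ^S zero  = oneS
f ^S suc k = f ⊛ (f ^S k)

excPoly : ∀ {n} → List (Vec (Fin n) n) → Series
excPoly L j = + length (filter (λ v → exc v ≟ j) L)

AE⁺ AE⁻ : ℕ → Series
AE⁺ n = excPoly (evenPerms n)
AE⁻ n = excPoly (oddPerms n)

RHS⁺ RHS⁻ : ℕ → Series
RHS⁺ n k = + ((suc k ℕ.^ n ℕ.+ suc k) / 2)
RHS⁻ n k = + ((suc k ℕ.^ n ∸ suc k) / 2)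

-- "A / (1-t)^{n+1} = S" as formal power series, i.e. A = (1-t)^{n+1} · S
-- (1-t)^{n+1} is invertible in ℤ[[t]])
_≐_/[1-t]^_ : Series → Series → ℕ → Set
S ≐ A /[1-t]^ e = ∀ m → A m ≡ ((oneMinusT ^S e) ⊛ S) m

-- Write a permutation of [n+1] as insertMax π o: the new largest value n+1 is put at position o
-- and the entry πₒ it displaces is moved to the end (in cycle notation, n+1 is inserted right
-- after o).  Every permutation of [n+1] arises exactly once in this way.  The choice o = n+1
-- changes neither the number of excedances nor the sign; every other o flips the sign and adds
-- one excedance exactly when o is not an excedance of π.  Hence the Eulerian numbers
-- A = AE⁺ + AE⁻ and their signed version D = AE⁺ - AE⁻ satisfy
--   Aₙ₊₁(j) = (1 + j) Aₙ(j) + (n + 1 - j) Aₙ(j - 1),   Dₙ₊₁(j) = (1 - j) Dₙ(j) - (n + 1 - j) Dₙ(j - 1).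
-- Multiplying by (1 - t)ᵉ is the e-fold difference operator Δᵉ on coefficients.  A Leibniz rule
-- for Δᵉ shows that Δⁿ⁺¹ (k + 1)ⁿ obeys the first recurrence, and Δⁿ⁺¹ (k + 1), the coefficients
-- of (1 - t)ⁿ⁻¹, obeys the second.  The initial values agree, and AE± = (A ± D) / 2.

module Submission where

open import Defs
open import Data.Bool.Base using (true; false; if_then_else_)
open import Data.Nat.Base as ℕ using (ℕ; zero; suc)
open import Data.Fin.Base using (Fin; zero; suc; toℕ; fromℕ; inject₁)
open import Relation.Binary.PropositionalEquality using (_≡_; _≢_; _≗_; refl; sym; trans; cong; cong₂; subst; subst₂; module ≡-Reasoning)
open import Relation.Nullary using (Dec; yes; no; does; ¬_; contradiction)
open import Relation.Nullary.Decidable using (_×-dec_)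
open import Function.Base using (_∘_; id)
open import Level using (Level)
import Data.Nat.Properties as ℕP
import Algebra.Properties.Semiring.Sum as SemiringSum

open SemiringSum ℕP.+-*-semiring

𝟙 : ∀ {p} {P : Set p} → Dec P → ℕ
𝟙 d = if does d then 1 else 0

𝟙-yes : ∀ {p} {P : Set p} (d : Dec P) → P → 𝟙 d ≡ 1
𝟙-yes (yes _) _ = refl
𝟙-yes (no ¬p) p = contradiction p ¬p

𝟙-no : ∀ {p} {P : Set p} (d : Dec P) → ¬ P → 𝟙 d ≡ 0
𝟙-no (yes p) ¬p = contradiction p ¬p
𝟙-no (no _) _ = refl

𝟙-×-dec : ∀ {p q} {P : Set p} {Q : Set q} (P? : Dec P) (Q? : Dec Q) → 𝟙 (P? ×-dec Q?) ≡ 𝟙 P? ℕ.* 𝟙 Q?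
𝟙-×-dec P? Q? with does P? | does Q?
... | true | true = refl
... | true | false = refl
... | false | _ = refl

module IntegerSums where

  open import Data.Integer.Base using (ℤ; +_; 0ℤ; 1ℤ; _+_; _*_)
  open import Data.List.Base using (List; []; _∷_; _++_; map; filter; length; tabulate; allFin; cartesianProductWith; cartesianProduct)
  open import Data.Product using (_×_; _,_)
  open import Data.List.Membership.Propositional using (_∈_)
  open import Data.List.Relation.Unary.Any using (here; there)
  open import Data.List.Relation.Binary.Permutation.Propositional as ↭ using (_↭_)
  open import Relation.Unary using (Decidable)
  open import Data.Integer.Properties
  import Algebra.Properties.CommutativeSemigroup +-commutativeSemigroup as +-Props
  open SemiringSum +-*-semiring public using ()
    renaming (sum to ∑ᶠ; sum-cong-≗ to ∑ᶠ-cong; sum-init-last to ∑ᶠ-init-last; *-distribʳ-sum to *-distribʳ-∑ᶠ)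

  private variable
    a b c p : Level
    A : Set a
    B : Set b
    C : Set c

  ∑ˡ : List A → (A → ℤ) → ℤ
  ∑ˡ [] f = 0ℤ
  ∑ˡ (x ∷ xs) f = f x + ∑ˡ xs f

  infix 5 ∑ˡ
  syntax ∑ˡ xs (λ x → e) = ∑[ x ∈ xs ] e

  ∑ˡ-zero : ∀ (xs : List A) → ∑[ x ∈ xs ] 0ℤ ≡ 0ℤ
  ∑ˡ-zero [] = refl
  ∑ˡ-zero (x ∷ xs) = trans (+-identityˡ _) (∑ˡ-zero xs)

  ∑ˡ-cong : ∀ {f g : A → ℤ} xs → (∀ {x} → x ∈ xs → f x ≡ g x) → ∑ˡ xs f ≡ ∑ˡ xs g
  ∑ˡ-cong [] _ = refl
  ∑ˡ-cong (x ∷ xs) f≡g = cong₂ _+_ (f≡g (here refl)) (∑ˡ-cong xs (f≡g ∘ there))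

  ∑ˡ-++ : ∀ xs ys (f : A → ℤ) → ∑ˡ (xs ++ ys) f ≡ ∑ˡ xs f + ∑ˡ ys f
  ∑ˡ-++ [] ys f = sym (+-identityˡ _)
  ∑ˡ-++ (x ∷ xs) ys f = trans (cong (λ s → f x + s) (∑ˡ-++ xs ys f)) (sym (+-assoc (f x) _ _))

  ∑ˡ-↭ : ∀ {xs ys} (f : A → ℤ) → xs ↭ ys → ∑ˡ xs f ≡ ∑ˡ ys f
  ∑ˡ-↭ f ↭.refl = refl
  ∑ˡ-↭ f (↭.prep x p) = cong (λ s → f x + s) (∑ˡ-↭ f p)
  ∑ˡ-↭ f (↭.swap x y p) = trans (cong (λ s → f x + (f y + s)) (∑ˡ-↭ f p)) (+-Props.x∙yz≈y∙xz (f x) (f y) _)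
  ∑ˡ-↭ f (↭.trans p q) = trans (∑ˡ-↭ f p) (∑ˡ-↭ f q)

  ∑ˡ-distrib-+ : ∀ xs (f g : A → ℤ) → ∑[ x ∈ xs ] (f x + g x) ≡ ∑ˡ xs f + ∑ˡ xs g
  ∑ˡ-distrib-+ [] f g = refl
  ∑ˡ-distrib-+ (x ∷ xs) f g = trans (cong (λ s → f x + g x + s) (∑ˡ-distrib-+ xs f g)) (+-Props.interchange (f x) (g x) _ _)

  *-distribˡ-∑ˡ : ∀ c xs (f : A → ℤ) → c * ∑ˡ xs f ≡ ∑[ x ∈ xs ] (c * f x)
  *-distribˡ-∑ˡ c [] f = *-zeroʳ c
  *-distribˡ-∑ˡ c (x ∷ xs) f = trans (*-distribˡ-+ c (f x) _) (cong (λ s → c * f x + s) (*-distribˡ-∑ˡ c xs f))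

  ∑ˡ-filter : {P : A → Set p} (P? : Decidable P) (xs : List A) (f : A → ℤ) →
              ∑ˡ (filter P? xs) f ≡ ∑[ x ∈ xs ] (+ 𝟙 (P? x) * f x)
  ∑ˡ-filter P? [] f = refl
  ∑ˡ-filter P? (x ∷ xs) f with does (P? x)
  ... | true = cong₂ _+_ (sym (*-identityˡ (f x))) (∑ˡ-filter P? xs f)
  ... | false = trans (∑ˡ-filter P? xs f) (sym (+-identityˡ _))  

  length-filter : {P : A → Set p} (P? : Decidable P) (xs : List A) →
                  + length (filter P? xs) ≡ ∑[ x ∈ xs ] + 𝟙 (P? x)
  length-filter P? [] = refl
  length-filter P? (x ∷ xs) with does (P? x)
  ... | true = cong (λ s → 1ℤ + s) (length-filter P? xs)
  ... | false = trans (length-filter P? xs) (sym (+-identityˡ _))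

  ∑ˡ-cartesianProductWith : (g : A → B → C) (xs : List A) (ys : List B) (f : C → ℤ) →
    ∑ˡ (cartesianProductWith g xs ys) f ≡ ∑[ x ∈ xs ] ∑[ y ∈ ys ] f (g x y)
  ∑ˡ-cartesianProductWith g [] ys f = refl
  ∑ˡ-cartesianProductWith g (x ∷ xs) ys f =
    trans (∑ˡ-++ (map (g x) ys) _ f) (cong₂ _+_ (∑ˡ-map ys) (∑ˡ-cartesianProductWith g xs ys f))
    where
    ∑ˡ-map : ∀ ys → ∑ˡ (map (g x) ys) f ≡ ∑[ y ∈ ys ] f (g x y)
    ∑ˡ-map [] = refl
    ∑ˡ-map (y ∷ ys) = cong (λ s → f (g x y) + s) (∑ˡ-map ys)

  ∑ˡ-tabulate : ∀ {n} (g : Fin n → A) (f : A → ℤ) → ∑ˡ (tabulate g) f ≡ ∑ᶠ (f ∘ g)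
  ∑ˡ-tabulate {n = zero} g f = refl
  ∑ˡ-tabulate {n = suc n} g f = cong (λ s → f (g zero) + s) (∑ˡ-tabulate (g ∘ suc) f)

  pos-sum : ∀ {n} (f : Fin n → ℕ) → + sum f ≡ ∑ᶠ (+_ ∘ f)
  pos-sum {zero} f = refl
  pos-sum {suc n} f = trans (pos-+ (f zero) _) (cong (λ s → + f zero + s) (pos-sum (f ∘ suc)))

  count-allFin : ∀ {n} {P : Fin n → Set p} (P? : Decidable P) → length (filter P? (allFin n)) ≡ ∑[ i < n ] 𝟙 (P? i)
  count-allFin {n = n} P? = +-injective (begin
    + length (filter P? (allFin n))  ≡⟨ length-filter P? (allFin n) ⟩
    ∑[ i ∈ allFin n ] + 𝟙 (P? i)      ≡⟨ ∑ˡ-tabulate id (λ i → + 𝟙 (P? i)) ⟩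
    ∑ᶠ (λ i → + 𝟙 (P? i))            ≡⟨ pos-sum (λ i → 𝟙 (P? i)) ⟨
    + sum (λ i → 𝟙 (P? i))           ∎)
    where open ≡-Reasoning

  count-allFin² : ∀ {n} {P : Fin n × Fin n → Set p} (P? : Decidable P) →
    length (filter P? (cartesianProduct (allFin n) (allFin n))) ≡ ∑[ k < n ] ∑[ l < n ] 𝟙 (P? (k , l))
  count-allFin² {n = n} P? = +-injective (begin
    + length (filter P? (cartesianProduct (allFin n) (allFin n)))
      ≡⟨ length-filter P? (cartesianProduct (allFin n) (allFin n)) ⟩
    ∑ˡ (cartesianProduct (allFin n) (allFin n)) (λ kl → + 𝟙 (P? kl))
      ≡⟨ ∑ˡ-cartesianProductWith _,_ (allFin n) (allFin n) _ ⟩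
    ∑[ k ∈ allFin n ] ∑[ l ∈ allFin n ] + 𝟙 (P? (k , l))
      ≡⟨ ∑ˡ-tabulate id (λ k → ∑[ l ∈ allFin n ] + 𝟙 (P? (k , l))) ⟩
    ∑ᶠ (λ k → ∑[ l ∈ allFin n ] + 𝟙 (P? (k , l)))
      ≡⟨ ∑ᶠ-cong (λ k → trans (∑ˡ-tabulate id (λ l → + 𝟙 (P? (k , l)))) (sym (pos-sum (λ l → 𝟙 (P? (k , l)))))) ⟩
    ∑ᶠ (λ k → + ∑[ l < n ] 𝟙 (P? (k , l)))
      ≡⟨ pos-sum (λ k → ∑[ l < n ] 𝟙 (P? (k , l))) ⟨
    + ∑[ k < n ] ∑[ l < n ] 𝟙 (P? (k , l)) ∎)
    where open ≡-Reasoning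

module PowerSeries where

  open import Data.Nat.Base using (_∸_; _^_)
  open import Data.Integer.Base using (ℤ; +_; -_; 0ℤ; 1ℤ; -1ℤ; _+_; _-_; _*_)
  open import Data.Integer.Properties
  open import Data.Integer.Tactic.RingSolver using (solve-∀)

  private variable
    f g : Series

  shift : Series → Series
  shift f zero = 0ℤ
  shift f (suc m) = f m

  Δ : Series → Series
  Δ f m = f m - shift f m

  Δ^ : ℕ → Series → Series
  Δ^ zero f = f
  Δ^ (suc e) f = Δ (Δ^ e f)

  shift-cong : f ≗ g → shift f ≗ shift g
  shift-cong f≗g zero = refl
  shift-cong f≗g (suc m) = f≗g m

  Δ-cong : f ≗ g → Δ f ≗ Δ g
  Δ-cong f≗g m = cong₂ _-_ (f≗g m) (shift-cong f≗g m)

  Δ^-cong : ∀ e → f ≗ g → Δ^ e f ≗ Δ^ e g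
  Δ^-cong zero f≗g = f≗g
  Δ^-cong (suc e) f≗g = Δ-cong (Δ^-cong e f≗g)

  Δ-+* : ∀ c f g m → Δ (λ k → f k + c * g k) m ≡ Δ f m + c * Δ g m
  Δ-+* c f g zero = lemma c (f 0) (g 0)
    where
    lemma : ∀ c x y → x + c * y - 0ℤ ≡ x - 0ℤ + c * (y - 0ℤ)
    lemma = solve-∀
  Δ-+* c f g (suc m) = lemma c (f (suc m)) (g (suc m)) (f m) (g m)
    where
    lemma : ∀ c x y x′ y′ → x + c * y - (x′ + c * y′) ≡ x - x′ + c * (y - y′)
    lemma = solve-∀

  Δ-* : ∀ c f m → Δ (λ k → c * f k) m ≡ c * Δ f m
  Δ-* c f zero = lemma c (f 0)
    where
    lemma : ∀ c x → c * x - 0ℤ ≡ c * (x - 0ℤ)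
    lemma = solve-∀
  Δ-* c f (suc m) = lemma c (f (suc m)) (f m)
    where
    lemma : ∀ c x y → c * x - c * y ≡ c * (x - y)
    lemma = solve-∀

  Δ^-+* : ∀ e c f g m → Δ^ e (λ k → f k + c * g k) m ≡ Δ^ e f m + c * Δ^ e g m
  Δ^-+* zero c f g m = refl
  Δ^-+* (suc e) c f g m = trans (Δ-cong (Δ^-+* e c f g) m) (Δ-+* c (Δ^ e f) (Δ^ e g) m)

  Δ^-* : ∀ e c f m → Δ^ e (λ k → c * f k) m ≡ c * Δ^ e f m
  Δ^-* zero c f m = refl
  Δ^-* (suc e) c f m = trans (Δ-cong (Δ^-* e c f) m) (Δ-* c (Δ^ e f) m)

  sumTo-cong : ∀ m {u v : ℕ → ℤ} → u ≗ v → sumTo m u ≡ sumTo m v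
  sumTo-cong zero u≗v = u≗v 0
  sumTo-cong (suc m) u≗v = cong₂ _+_ (sumTo-cong m u≗v) (u≗v (suc m))

  sumTo-unsnoc : ∀ m (u : ℕ → ℤ) → sumTo (suc m) u ≡ u 0 + sumTo m (u ∘ suc)
  sumTo-unsnoc zero u = refl
  sumTo-unsnoc (suc m) u = trans (cong (_+ u (suc (suc m))) (sumTo-unsnoc m u)) (+-assoc (u 0) _ _)

  sumTo-distrib-minus : ∀ m (u v : ℕ → ℤ) → sumTo m (λ j → u j - v j) ≡ sumTo m u - sumTo m v
  sumTo-distrib-minus zero u v = refl
  sumTo-distrib-minus (suc m) u v =
    trans (cong (_+ (u (suc m) - v (suc m))) (sumTo-distrib-minus m u v))
          (lemma (sumTo m u) (sumTo m v) (u (suc m)) (v (suc m)))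
    where
    lemma : ∀ a b c d → a - b + (c - d) ≡ a + c - (b + d)
    lemma = solve-∀

  ⊛-congˡ : f ≗ g → ∀ h → (f ⊛ h) ≗ (g ⊛ h)
  ⊛-congˡ f≗g h m = sumTo-cong m (λ j → cong (_* h (m ∸ j)) (f≗g j))

  oneS-⊛ : ∀ f → (oneS ⊛ f) ≗ f
  oneS-⊛ f m = picks-0 m (λ j → f (m ∸ j))
    where
    picks-0 : ∀ m (u : ℕ → ℤ) → sumTo m (λ j → oneS j * u j) ≡ u 0
    picks-0 zero u = *-identityˡ (u 0)
    picks-0 (suc m) u = trans (cong (_+ 0ℤ) (picks-0 m u)) (+-identityʳ (u 0))

  oneMinusT-⊛ : ∀ f → (oneMinusT ⊛ f) ≗ Δ f
  oneMinusT-⊛ f zero = trans (*-identityˡ (f 0)) (sym (+-identityʳ (f 0)))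
  oneMinusT-⊛ f (suc m) = picks-01 m (λ j → f (suc m ∸ j))
    where
    picks-01 : ∀ m (u : ℕ → ℤ) → sumTo (suc m) (λ j → oneMinusT j * u j) ≡ u 0 - u 1
    picks-01 zero u = lemma (u 0) (u 1)
      where
      lemma : ∀ x y → 1ℤ * x + -1ℤ * y ≡ x - y
      lemma = solve-∀
    picks-01 (suc m) u = trans (cong (_+ 0ℤ) (picks-01 m u)) (+-identityʳ _)

  Δ-⊛ : ∀ f g → (Δ f ⊛ g) ≗ Δ (f ⊛ g)
  Δ-⊛ f g m = begin
    sumTo m (λ j → (f j - shift f j) * g (m ∸ j))
      ≡⟨ sumTo-cong m (λ j → distrib (f j) (shift f j) (g (m ∸ j))) ⟩
    sumTo m (λ j → f j * g (m ∸ j) - shift f j * g (m ∸ j))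
      ≡⟨ sumTo-distrib-minus m _ _ ⟩
    (f ⊛ g) m - sumTo m (λ j → shift f j * g (m ∸ j))
      ≡⟨ cong (λ s → (f ⊛ g) m - s) (shifted m) ⟩
    Δ (f ⊛ g) m ∎
    where
    open ≡-Reasoning
    distrib : ∀ x y z → (x - y) * z ≡ x * z - y * z
    distrib = solve-∀
    shifted : ∀ m → sumTo m (λ j → shift f j * g (m ∸ j)) ≡ shift (f ⊛ g) m
    shifted zero = *-zeroˡ (g 0)
    shifted (suc m) = trans (sumTo-unsnoc m _) (trans (cong (_+ (f ⊛ g) m) (*-zeroˡ (g (suc m)))) (+-identityˡ _))

  [1-t]^-⊛ : ∀ e f → ((oneMinusT ^S e) ⊛ f) ≗ Δ^ e f
  [1-t]^-⊛ zero f = oneS-⊛ f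
  [1-t]^-⊛ (suc e) f m = begin
    ((oneMinusT ⊛ (oneMinusT ^S e)) ⊛ f) m ≡⟨ ⊛-congˡ (oneMinusT-⊛ (oneMinusT ^S e)) f m ⟩
    (Δ (oneMinusT ^S e) ⊛ f) m             ≡⟨ Δ-⊛ (oneMinusT ^S e) f m ⟩
    Δ ((oneMinusT ^S e) ⊛ f) m             ≡⟨ Δ-cong ([1-t]^-⊛ e f) m ⟩
    Δ^ (suc e) f m                         ∎
    where open ≡-Reasoning

  weighted : Series → Series
  weighted f k = + suc k * f k

  Δ-shift : ∀ f → Δ (shift f) ≗ shift (Δ f)
  Δ-shift f zero = refl
  Δ-shift f (suc zero) = refl
  Δ-shift f (suc (suc k)) = refl

  Δ-weighted : ∀ f k → Δ (weighted f) k ≡ weighted (Δ f) k + shift f k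
  Δ-weighted f zero = lemma (f 0)
    where
    lemma : ∀ x → + 1 * x - 0ℤ ≡ + 1 * (x - 0ℤ) + 0ℤ
    lemma = solve-∀
  Δ-weighted f (suc k) = lemma (+ suc k) (f (suc k)) (f k)
    where
    lemma : ∀ K x y → (1ℤ + K) * x - K * y ≡ (1ℤ + K) * (x - y) + y
    lemma = solve-∀

  Δ^-weighted : ∀ r f k →
    Δ^ (suc r) (weighted f) k ≡ weighted (Δ^ (suc r) f) k + + suc r * shift (Δ^ r f) k
  Δ^-weighted zero f k = trans (Δ-weighted f k) (cong (λ s → weighted (Δ f) k + s) (sym (*-identityˡ _)))
  Δ^-weighted (suc r) f k = begin
    Δ (Δ^ (suc r) (weighted f)) k
      ≡⟨ Δ-cong (Δ^-weighted r f) k ⟩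
    Δ (λ k → weighted d₁ k + + suc r * shift d₀ k) k
      ≡⟨ Δ-+* (+ suc r) (weighted d₁) (shift d₀) k ⟩
    Δ (weighted d₁) k + + suc r * Δ (shift d₀) k
      ≡⟨ cong₂ (λ x y → x + + suc r * y) (Δ-weighted d₁ k) (Δ-shift d₀ k) ⟩
    weighted (Δ d₁) k + shift d₁ k + + suc r * shift d₁ k
      ≡⟨ lemma (weighted (Δ d₁) k) (shift d₁ k) (+ suc r) ⟩
    weighted (Δ d₁) k + + suc (suc r) * shift d₁ k ∎
    where
    open ≡-Reasoning
    d₁ d₀ : Series
    d₁ = Δ^ (suc r) f
    d₀ = Δ^ r f
    lemma : ∀ x y R → x + y + R * y ≡ x + (1ℤ + R) * y
    lemma = solve-∀

  -- c = 1 gives the Eulerian recurrence, c = -1 its signed version.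
  step : ℤ → ℕ → Series → Series
  step c n f j = (1ℤ + c * + j) * f j + c * (+ suc n - + j) * shift f j

  step-cong : ∀ c n → f ≗ g → step c n f ≗ step c n g
  step-cong c n f≗g j = cong₂ (λ x y → (1ℤ + c * + j) * x + c * (+ suc n - + j) * y) (f≗g j) (shift-cong f≗g j)

  powers : ℕ → Series
  powers n k = + (suc k ^ n)

  eulerian : ℕ → Series
  eulerian n = Δ^ (suc n) (powers n)

  eulerian-suc : ∀ n → eulerian (suc n) ≗ step 1ℤ n (eulerian n)
  eulerian-suc n j = begin
    Δ^ (suc (suc n)) (powers (suc n)) j
      ≡⟨ Δ^-cong (suc (suc n)) (λ k → pos-* (suc k) (suc k ^ n)) j ⟩
    Δ^ (suc (suc n)) (weighted (powers n)) j
      ≡⟨ Δ^-weighted (suc n) (powers n) j ⟩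
    weighted (Δ (eulerian n)) j + + suc (suc n) * shift (eulerian n) j
      ≡⟨ lemma (+ j) (+ n) (eulerian n j) (shift (eulerian n) j) ⟩
    step 1ℤ n (eulerian n) j ∎
    where
    open ≡-Reasoning
    lemma : ∀ J N x y → (1ℤ + J) * (x - y) + (+ 2 + N) * y ≡ (1ℤ + 1ℤ * J) * x + 1ℤ * (1ℤ + N - J) * y
    lemma = solve-∀

  signedEulerian : ℕ → Series
  signedEulerian n = Δ^ (suc n) (λ k → + suc k)

  Δ-naturals : ∀ i → Δ (λ k → + suc k) (suc i) ≡ 1ℤ
  Δ-naturals i = lemma (+ suc i)
    where
    lemma : ∀ I → 1ℤ + I - I ≡ 1ℤ
    lemma = solve-∀

  signedEulerian-one : signedEulerian 1 ≗ oneS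
  signedEulerian-one zero = refl
  signedEulerian-one (suc zero) = refl
  signedEulerian-one (suc (suc j)) rewrite Δ-naturals (suc j) | Δ-naturals j = refl

  -- The ratio recurrence j·rⱼ = -(N + 1 - j)·rⱼ₋₁ of the coefficients rⱼ = (-1)ʲ C(N, j) of (1 - t)ᴺ.
  Binomial : ℕ → Series → Set
  Binomial N r = ∀ j → + j * r j ≡ - (+ suc N - + j) * shift r j

  Binomial-Δ : ∀ {N r} → Binomial N r → Binomial (suc N) (Δ r)
  Binomial-Δ {N} {r} b zero = trans (*-zeroˡ (Δ r 0)) (sym (*-zeroʳ (- (+ suc (suc N) - 0ℤ))))
  Binomial-Δ {N} {r} b (suc i) = begin
    (1ℤ + I) * (r (suc i) - r i)                     ≡⟨ lemma₁ I (r (suc i)) (r i) ⟩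
    (1ℤ + I) * r (suc i) - (1ℤ + I) * r i            ≡⟨ cong (_- (1ℤ + I) * r i) (b (suc i)) ⟩
    - (1ℤ + M - (1ℤ + I)) * r i - (1ℤ + I) * r i    ≡⟨ lemma₂ I M (r i) ⟩
    - (1ℤ + M - I) * r i - I * r i                   ≡⟨ cong (λ t → - (1ℤ + M - I) * r i - t) (b i) ⟩
    - (1ℤ + M - I) * r i - - (1ℤ + M - I) * shift r i ≡⟨ lemma₃ I M (r i) (shift r i) ⟩
    - (1ℤ + (1ℤ + M) - (1ℤ + I)) * (r i - shift r i) ∎
    where
    open ≡-Reasoning
    I M : ℤ
    I = + i
    M = + N
    lemma₁ : ∀ I x y → (1ℤ + I) * (x - y) ≡ (1ℤ + I) * x - (1ℤ + I) * y
    lemma₁ = solve-∀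
    lemma₂ : ∀ I M y → - (1ℤ + M - (1ℤ + I)) * y - (1ℤ + I) * y ≡ - (1ℤ + M - I) * y - I * y
    lemma₂ = solve-∀
    lemma₃ : ∀ I M y z → - (1ℤ + M - I) * y - - (1ℤ + M - I) * z ≡ - (1ℤ + (1ℤ + M) - (1ℤ + I)) * (y - z)
    lemma₃ = solve-∀

  Binomial⇒step : ∀ {N r} → Binomial N r → step -1ℤ (suc N) r ≗ Δ r
  Binomial⇒step {N} {r} b j = begin
    (1ℤ + -1ℤ * J) * r j + -1ℤ * (1ℤ + (1ℤ + M) - J) * shift r j ≡⟨ lemma₁ J M (r j) (shift r j) ⟩
    r j - J * r j - (1ℤ + (1ℤ + M) - J) * shift r j             ≡⟨ cong (λ t → r j - t - (1ℤ + (1ℤ + M) - J) * shift r j) (b j) ⟩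
    r j - - (1ℤ + M - J) * shift r j - (1ℤ + (1ℤ + M) - J) * shift r j ≡⟨ lemma₂ J M (r j) (shift r j) ⟩
    r j - shift r j ∎
    where
    open ≡-Reasoning
    J M : ℤ
    J = + j
    M = + N
    lemma₁ : ∀ J M x y → (1ℤ + -1ℤ * J) * x + -1ℤ * (1ℤ + (1ℤ + M) - J) * y ≡ x - J * x - (1ℤ + (1ℤ + M) - J) * y
    lemma₁ = solve-∀
    lemma₂ : ∀ J M x y → x - - (1ℤ + M - J) * y - (1ℤ + (1ℤ + M) - J) * y ≡ x - y
    lemma₂ = solve-∀

  signedEulerian-Binomial : ∀ m → Binomial m (signedEulerian (suc m))
  signedEulerian-Binomial zero zero = refl
  signedEulerian-Binomial zero (suc j) rewrite signedEulerian-one (suc j) | signedEulerian-one j =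
    trans (*-zeroʳ (+ suc j)) (sym (shift-oneS j))
    where
    shift-oneS : ∀ j → - (1ℤ - + suc j) * oneS j ≡ 0ℤ
    shift-oneS zero = refl
    shift-oneS (suc j) = *-zeroʳ (- (1ℤ - + suc (suc j)))
  signedEulerian-Binomial (suc m) = Binomial-Δ (signedEulerian-Binomial m)

  signedEulerian-suc : ∀ m → signedEulerian (suc (suc m)) ≗ step -1ℤ (suc m) (signedEulerian (suc m))
  signedEulerian-suc m j = sym (Binomial⇒step (signedEulerian-Binomial m) j)

module InsertMax where

  open import Data.Fin.Base using (lower₁)
  import Data.Fin.Properties as Fin
  open import Data.Fin.Permutation.Components using (transpose; transpose-inverse)
  open import Data.Fin.Relation.Unary.Top using (view; ‵fromℕ; ‵inj₁; view-fromℕ; view-inject₁)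
  open import Data.Vec.Base using (Vec; lookup; tabulate)
  open import Data.Vec.Properties using (lookup∘tabulate; tabulate∘lookup; tabulate-cong)
  open import Data.Product using (Σ; _×_; _,_; proj₁; proj₂)
  open import Relation.Nullary.Decidable using (dec-true; dec-false)

  private variable
    n : ℕ

  lookup-≗⇒≡ : ∀ {a} {A : Set a} (v w : Vec A n) → lookup v ≗ lookup w → v ≡ w
  lookup-≗⇒≡ v w v≗w = trans (sym (tabulate∘lookup v)) (trans (tabulate-cong v≗w) (tabulate∘lookup w))

  transpose-matchˡ : ∀ (i j : Fin n) → transpose i j i ≡ j
  transpose-matchˡ i j rewrite dec-true (i Fin.≟ i) refl = refl

  transpose-matchʳ : ∀ (i j : Fin n) → transpose i j j ≡ i
  transpose-matchʳ i j with j Fin.≟ i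
  ... | yes j≡i = j≡i
  ... | no _ rewrite dec-true (j Fin.≟ j) refl = refl

  transpose-other : ∀ {i j k : Fin n} → k ≢ i → k ≢ j → transpose i j k ≡ k
  transpose-other {i = i} {j} {k} k≢i k≢j rewrite dec-false (k Fin.≟ i) k≢i | dec-false (k Fin.≟ j) k≢j = refl

  transpose-injective : ∀ (i j : Fin n) {k l} → transpose i j k ≡ transpose i j l → k ≡ l
  transpose-injective i j {k} {l} eq =
    trans (sym (transpose-inverse j i)) (trans (cong (transpose j i) eq) (transpose-inverse j i))

  extend : (Fin n → Fin n) → Fin (suc n) → Fin (suc n)
  extend p i with view i
  ... | ‵fromℕ = fromℕ _
  ... | ‵inj₁ {i = j} _ = inject₁ (p j)

  extend-fromℕ : ∀ (p : Fin n → Fin n) → extend p (fromℕ n) ≡ fromℕ n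
  extend-fromℕ {n} p rewrite view-fromℕ n = refl

  extend-inject₁ : ∀ (p : Fin n → Fin n) i → extend p (inject₁ i) ≡ inject₁ (p i)
  extend-inject₁ p i rewrite view-inject₁ i = refl

  extend≡fromℕ : ∀ (p : Fin n → Fin n) {i} → extend p i ≡ fromℕ n → i ≡ fromℕ n
  extend≡fromℕ p {i} eq with view i
  ... | ‵fromℕ = refl
  ... | ‵inj₁ _ = contradiction (sym eq) Fin.fromℕ≢inject₁

  extend-injective : ∀ (p : Fin n → Fin n) → (∀ {i j} → p i ≡ p j → i ≡ j) →
                     ∀ {i j} → extend p i ≡ extend p j → i ≡ j
  extend-injective p p-inj {i} {j} eq with view i | view j
  ... | ‵fromℕ | ‵fromℕ = refl
  ... | ‵fromℕ | ‵inj₁ _ = contradiction eq Fin.fromℕ≢inject₁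
  ... | ‵inj₁ _ | ‵fromℕ = contradiction (sym eq) Fin.fromℕ≢inject₁
  ... | ‵inj₁ _ | ‵inj₁ _ = cong inject₁ (p-inj (Fin.inject₁-injective eq))

  insertMax : Vec (Fin n) n → Fin (suc n) → Vec (Fin (suc n)) (suc n)
  insertMax {n} π o = tabulate (extend (lookup π) ∘ transpose o (fromℕ n))

  module _ (π : Vec (Fin n) n) (o : Fin (suc n)) where

    lookup-insertMax : ∀ k → lookup (insertMax π o) k ≡ extend (lookup π) (transpose o (fromℕ n) k)
    lookup-insertMax = lookup∘tabulate _

    insertMax-at : lookup (insertMax π o) o ≡ fromℕ n
    insertMax-at = trans (lookup-insertMax o) (trans (cong (extend (lookup π)) (transpose-matchˡ o (fromℕ n))) (extend-fromℕ (lookup π)))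

    insertMax-fromℕ : lookup (insertMax π o) (fromℕ n) ≡ extend (lookup π) o
    insertMax-fromℕ = trans (lookup-insertMax (fromℕ n)) (cong (extend (lookup π)) (transpose-matchʳ o (fromℕ n)))

    insertMax-other : ∀ {k} → k ≢ o → k ≢ fromℕ n → lookup (insertMax π o) k ≡ extend (lookup π) k
    insertMax-other {k} k≢o k≢n = trans (lookup-insertMax k) (cong (extend (lookup π)) (transpose-other k≢o k≢n))

    insertMax≡fromℕ : ∀ {k} → lookup (insertMax π o) k ≡ fromℕ n → k ≡ o
    insertMax≡fromℕ {k} eq = transpose-injective o (fromℕ n)
      (trans (extend≡fromℕ (lookup π) (trans (sym (lookup-insertMax k)) eq)) (sym (transpose-matchˡ o (fromℕ n))))

    insertMax-untranspose : ∀ j → lookup (insertMax π o) (transpose (fromℕ n) o (inject₁ j)) ≡ inject₁ (lookup π j)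
    insertMax-untranspose j =
      trans (lookup-insertMax (transpose (fromℕ n) o (inject₁ j)))
            (trans (cong (extend (lookup π)) (transpose-inverse o (fromℕ n) {inject₁ j})) (extend-inject₁ (lookup π) j))

    insertMax-IsPerm : IsPerm π → IsPerm (insertMax π o)
    insertMax-IsPerm π-perm k l eq = transpose-injective o (fromℕ n)
      (extend-injective (lookup π) (π-perm _ _) (trans (sym (lookup-insertMax k)) (trans eq (lookup-insertMax l))))

  insertMax-injective : ∀ {π π′ : Vec (Fin n) n} {o o′} → insertMax π o ≡ insertMax π′ o′ → π ≡ π′ × o ≡ o′
  insertMax-injective {π = π} {π′} {o} {o′} eq
    with insertMax≡fromℕ π′ o′ {o} (trans (cong (λ v → lookup v o) (sym eq)) (insertMax-at π o))
  ... | refl = lookup-≗⇒≡ π π′ π≗π′ , refl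
    where
    π≗π′ : lookup π ≗ lookup π′
    π≗π′ j = Fin.inject₁-injective (begin
      inject₁ (lookup π j)                                       ≡⟨ insertMax-untranspose π o j ⟨
      lookup (insertMax π o) (transpose (fromℕ _) o (inject₁ j))  ≡⟨ cong (λ v → lookup v (transpose (fromℕ _) o (inject₁ j))) eq ⟩
      lookup (insertMax π′ o) (transpose (fromℕ _) o (inject₁ j)) ≡⟨ insertMax-untranspose π′ o j ⟩
      inject₁ (lookup π′ j)                                      ∎)
      where open ≡-Reasoning

  injective⇒hits-fromℕ : ∀ (s : Fin (suc n) → Fin (suc n)) → (∀ {i j} → s i ≡ s j → i ≡ j) →
                         Σ (Fin (suc n)) (λ o → s o ≡ fromℕ n)
  injective⇒hits-fromℕ {n} s s-inj with Fin.any? (λ k → s k Fin.≟ fromℕ n)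
  ... | yes hit = hit
  ... | no miss = contradiction (λ {i j} eq → s-inj (Fin.lower₁-injective {i = s i} {j = s j} eq))
                                (Fin.<⇒notInjective {f = lowered} (ℕP.n<1+n n))
    where
    avoid : ∀ k → n ≢ toℕ (s k)
    avoid k n≡sk = miss (k , Fin.toℕ-injective (trans (sym n≡sk) (sym (Fin.toℕ-fromℕ n))))
    lowered : Fin (suc n) → Fin n
    lowered k = lower₁ (s k) (avoid k)

  insertMax-surjective : ∀ (σ : Vec (Fin (suc n)) (suc n)) → IsPerm σ →
                         Σ (Vec (Fin n) n) λ π → Σ (Fin (suc n)) λ o → IsPerm π × insertMax π o ≡ σ
  insertMax-surjective {n} σ σ-perm = π , o , π-perm , lookup-≗⇒≡ (insertMax π o) σ agree
    where
    L : Fin (suc n)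
    L = fromℕ n
    hit : Σ (Fin (suc n)) (λ o → lookup σ o ≡ L)
    hit = injective⇒hits-fromℕ (lookup σ) (σ-perm _ _)
    o : Fin (suc n)
    o = proj₁ hit
    σo≡L : lookup σ o ≡ L
    σo≡L = proj₂ hit
    source : Fin n → Fin (suc n)
    source j = transpose L o (inject₁ j)
    avoid : ∀ j → n ≢ toℕ (lookup σ (source j))
    avoid j n≡σx = Fin.fromℕ≢inject₁ (sym (begin
      inject₁ j                        ≡⟨ transpose-inverse o L ⟨
      transpose o L (source j)         ≡⟨ cong (transpose o L) source≡o ⟩
      transpose o L o                  ≡⟨ transpose-matchˡ o L ⟩
      L                                ∎))
      where
      open ≡-Reasoning
      source≡o : source j ≡ o
      source≡o = σ-perm _ _ (trans (Fin.toℕ-injective (trans (sym n≡σx) (sym (Fin.toℕ-fromℕ n)))) (sym σo≡L))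
    π : Vec (Fin n) n
    π = tabulate (λ j → lower₁ (lookup σ (source j)) (avoid j))
    lookup-π : ∀ j → inject₁ (lookup π j) ≡ lookup σ (source j)
    lookup-π j = trans (cong inject₁ (lookup∘tabulate _ j)) (Fin.inject₁-lower₁ _ (avoid j))
    π-perm : IsPerm π
    π-perm i j eq = Fin.inject₁-injective (transpose-injective L o
      (σ-perm _ _ (trans (sym (lookup-π i)) (trans (cong inject₁ eq) (lookup-π j)))))
    extend-agrees : ∀ {k} x → transpose o L k ≡ x → extend (lookup π) x ≡ lookup σ k
    extend-agrees {k} x τk≡x with view x
    ... | ‵fromℕ = sym (trans (cong (lookup σ) (transpose-injective o L (trans τk≡x (sym (transpose-matchˡ o L))))) σo≡L)
    ... | ‵inj₁ {i = j} _ = trans (lookup-π j) (cong (lookup σ) (trans (cong (transpose L o) (sym τk≡x)) (transpose-inverse L o)))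
    agree : ∀ k → lookup (insertMax π o) k ≡ lookup σ k
    agree k = trans (lookup-insertMax π o k) (extend-agrees (transpose o L k) refl)

module PermutationList where

  open InsertMax using (insertMax; insertMax-injective; insertMax-IsPerm; insertMax-surjective)
  open import Data.Vec.Base using (Vec; []; _∷_)
  open import Data.Vec.Properties using (∷-injective)
  open import Data.Product using (_,_; proj₂; swap)
  open import Data.List.Base using ([]; _∷_; _++_; map; concatMap; allFin; cartesianProductWith)
  open import Data.List.Membership.Propositional using (_∈_)
  open import Data.List.Membership.Propositional.Properties
    using (∈-filter⁺; ∈-filter⁻; ∈-cartesianProductWith⁺; ∈-cartesianProductWith⁻; ∈-allFin)
  open import Data.List.Membership.Propositional.Properties.WithK using (unique∧set⇒bag)
  open import Data.List.Relation.Unary.Any using (here)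
  import Data.List.Relation.Unary.All as All
  import Data.List.Relation.Unary.AllPairs as AllPairs
  open import Data.List.Relation.Unary.Unique.Propositional using (Unique)
  import Data.List.Relation.Unary.Unique.Propositional.Properties as Unique
  open import Data.List.Relation.Binary.BagAndSetEquality using (∼bag⇒↭)
  open import Data.List.Relation.Binary.Permutation.Propositional using (_↭_)
  open import Function.Bundles using (mk⇔)

  private variable
    n m : ℕ

  words-suc : words n (suc m) ≡ cartesianProductWith (λ w i → i ∷ w) (words n m) (allFin n)
  words-suc {n} {m} = concatMap-map (words n m)
    where
    concatMap-map : ∀ ws → concatMap (λ w → map (_∷ w) (allFin n)) ws ≡ cartesianProductWith (λ w i → i ∷ w) ws (allFin n)
    concatMap-map [] = refl
    concatMap-map (w ∷ ws) = cong (map (_∷ w) (allFin n) ++_) (concatMap-map ws)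

  words-unique : ∀ n m → Unique (words n m)
  words-unique n zero = All.[] AllPairs.∷ AllPairs.[]
  words-unique n (suc m) rewrite words-suc {n} {m} =
    Unique.cartesianProductWith⁺ (λ w i → i ∷ w) (swap ∘ ∷-injective) (words-unique n m) (Unique.allFin⁺ n)

  ∈-words : ∀ (v : Vec (Fin n) m) → v ∈ words n m
  ∈-words [] = here refl
  ∈-words {n} {suc m} (i ∷ v) rewrite words-suc {n} {m} =
    ∈-cartesianProductWith⁺ (λ w i → i ∷ w) (∈-words v) (∈-allFin i)

  perms-unique : ∀ n → Unique (perms n)
  perms-unique n = Unique.filter⁺ isPerm? (words-unique n n)

  IsPerm⇒∈-perms : ∀ {v : Vec (Fin n) n} → IsPerm v → v ∈ perms n
  IsPerm⇒∈-perms {v = v} = ∈-filter⁺ isPerm? (∈-words v)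

  ∈-perms⇒IsPerm : ∀ {v : Vec (Fin n) n} → v ∈ perms n → IsPerm v
  ∈-perms⇒IsPerm {n} v∈ = proj₂ (∈-filter⁻ isPerm? {xs = words n n} v∈)

  perms-suc-↭ : ∀ n → perms (suc n) ↭ cartesianProductWith insertMax (perms n) (allFin (suc n))
  perms-suc-↭ n = ∼bag⇒↭ (unique∧set⇒bag (perms-unique (suc n))
    (Unique.cartesianProductWith⁺ insertMax insertMax-injective (perms-unique n) (Unique.allFin⁺ (suc n)))
    (mk⇔ decompose compose))
    where
    decompose : ∀ {σ} → σ ∈ perms (suc n) → σ ∈ cartesianProductWith insertMax (perms n) (allFin (suc n))
    decompose {σ} σ∈ with insertMax-surjective σ (∈-perms⇒IsPerm {v = σ} σ∈)
    ... | π , o , π-perm , refl = ∈-cartesianProductWith⁺ insertMax (IsPerm⇒∈-perms {v = π} π-perm) (∈-allFin o)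
    compose : ∀ {σ} → σ ∈ cartesianProductWith insertMax (perms n) (allFin (suc n)) → σ ∈ perms (suc n)
    compose σ∈ with ∈-cartesianProductWith⁻ insertMax (perms n) (allFin (suc n)) σ∈
    ... | π , o , π∈ , _ , refl = IsPerm⇒∈-perms (insertMax-IsPerm π o (∈-perms⇒IsPerm {v = π} π∈))

module NaturalSums where

  open import Data.Nat.Base using (_+_)
  open import Data.Nat.Properties using (+-cancelʳ-≡)
  open import Data.Nat.Tactic.RingSolver using (solve-∀)
  open import Data.Fin.Base using (punchIn)
  import Data.Fin.Properties as Fin

  private variable
    n : ℕ

  ∑-zero : ∀ {f : Fin n → ℕ} → (∀ i → f i ≡ 0) → sum f ≡ 0
  ∑-zero {n} f≡0 = trans (sum-cong-≗ f≡0) (sum-replicate-zero n)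

  ∑-update : ∀ {f g : Fin n → ℕ} a → (∀ k → k ≢ a → f k ≡ g k) → sum f + g a ≡ sum g + f a
  ∑-update {suc n} {f} {g} a f≡g = begin
    sum f + g a                         ≡⟨ cong (_+ g a) (sum-remove {i = a} f) ⟩
    f a + sum (f ∘ punchIn a) + g a     ≡⟨ cong (λ s → f a + s + g a) (sum-cong-≗ (λ j → f≡g _ (Fin.punchInᵢ≢i a j))) ⟩
    f a + sum (g ∘ punchIn a) + g a     ≡⟨ lemma (f a) (sum (g ∘ punchIn a)) (g a) ⟩
    g a + sum (g ∘ punchIn a) + f a     ≡⟨ cong (_+ f a) (sum-remove {i = a} g) ⟨
    sum g + f a                         ∎
    where
    open ≡-Reasoning
    lemma : ∀ x s y → x + s + y ≡ y + s + x
    lemma = solve-∀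

  ∑²-update : ∀ {F G : Fin n → Fin n → ℕ} a → (∀ k l → k ≢ a → l ≢ a → F k l ≡ G k l) → F a a ≡ G a a →
              ∑[ k < n ] sum (F k) + ∑[ l < n ] (G a l + G l a) ≡ ∑[ k < n ] sum (G k) + ∑[ l < n ] (F a l + F l a)
  ∑²-update {n} {F} {G} a F≡G Faa≡Gaa = +-cancelʳ-≡ (F a a) _ _ (begin
    ∑∑F + sum (λ l → G a l + G l a) + F a a    ≡⟨ cong (λ s → ∑∑F + s + F a a) (∑-distrib-+ (G a) (λ l → G l a)) ⟩
    ∑∑F + (sum (G a) + colG) + F a a           ≡⟨ lemma ∑∑F (sum (G a)) colG (F a a) ⟩
    ∑∑F + colG + (sum (G a) + F a a)           ≡⟨ cong (_+ (sum (G a) + F a a)) (∑-distrib-+ (sum ∘ F) (λ k → G k a)) ⟨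
    sum (λ k → sum (F k) + G k a) + (sum (G a) + F a a)
                                               ≡⟨ ∑-update a (λ k k≢a → ∑-update a (λ l l≢a → F≡G k l k≢a l≢a)) ⟩
    sum (λ k → sum (G k) + F k a) + (sum (F a) + G a a)
                                               ≡⟨ cong₂ (λ s d → s + (sum (F a) + d))
                                                        (∑-distrib-+ (sum ∘ G) (λ k → F k a)) (sym Faa≡Gaa) ⟩
    ∑∑G + colF + (sum (F a) + F a a)           ≡⟨ lemma ∑∑G (sum (F a)) colF (F a a) ⟨
    ∑∑G + (sum (F a) + colF) + F a a           ≡⟨ cong (λ s → ∑∑G + s + F a a) (∑-distrib-+ (F a) (λ l → F l a)) ⟨
    ∑∑G + sum (λ l → F a l + F l a) + F a a    ∎)
    where
    open ≡-Reasoning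
    ∑∑F ∑∑G colF colG : ℕ
    ∑∑F = ∑[ k < n ] sum (F k)
    ∑∑G = ∑[ k < n ] sum (G k)
    colF = ∑[ k < n ] F k a
    colG = ∑[ k < n ] G k a
    lemma : ∀ s r c d → s + (r + c) + d ≡ s + c + (r + d)
    lemma = solve-∀

module PermutationStatistics where

  open import Data.Nat.Base using (_+_; _*_; _≤_; _<_; s≤s⁻¹)
  open import Relation.Nullary.Decidable using (¬?)
  open import Data.Nat.Properties
  open import Data.Nat.Tactic.RingSolver using (solve-∀)
  import Data.Fin.Properties as Fin
  open import Data.Vec.Base using (Vec; lookup)
  open import Data.Product using (_,_)
  open import Relation.Binary.Definitions using (tri<; tri≈; tri>)
  open IntegerSums using (count-allFin; count-allFin²)
  open NaturalSums
  open InsertMax using (insertMax; insertMax-at; insertMax-other; insertMax-fromℕ; extend; extend-inject₁)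

  private variable
    m n : ℕ

  values : Vec (Fin n) n → Fin n → ℕ
  values v = toℕ ∘ lookup v

  excedances : (Fin m → ℕ) → ℕ
  excedances {m} h = ∑[ i < m ] 𝟙 (toℕ i <? h i)

  nonExcedances : (Fin m → ℕ) → ℕ
  nonExcedances {m} h = ∑[ i < m ] 𝟙 (¬? (toℕ i <? h i))

  excedances+nonExcedances : ∀ (h : Fin m → ℕ) → excedances h + nonExcedances h ≡ m
  excedances+nonExcedances {m} h = begin
    excedances h + nonExcedances h
      ≡⟨ ∑-distrib-+ (λ i → 𝟙 (toℕ i <? h i)) (λ i → 𝟙 (¬? (toℕ i <? h i))) ⟨
    ∑[ i < m ] (𝟙 (toℕ i <? h i) + 𝟙 (¬? (toℕ i <? h i)))
      ≡⟨ sum-cong-≗ (λ i → 𝟙+𝟙¬ (toℕ i <? h i)) ⟩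
    ∑[ i < m ] 1
      ≡⟨ ∑-one m ⟩
    m ∎
    where
    open ≡-Reasoning
    𝟙+𝟙¬ : ∀ {p} {P : Set p} (P? : Dec P) → 𝟙 P? + 𝟙 (¬? P?) ≡ 1
    𝟙+𝟙¬ (yes _) = refl
    𝟙+𝟙¬ (no _) = refl
    ∑-one : ∀ m → ∑[ i < m ] 1 ≡ m
    ∑-one zero = refl
    ∑-one (suc m) = cong suc (∑-one m)

  inverted : (Fin m → ℕ) → Fin m → Fin m → ℕ
  inverted h k l = 𝟙 (toℕ k <? toℕ l) * 𝟙 (h l <? h k)

  inversions : (Fin m → ℕ) → ℕ
  inversions {m} h = ∑[ k < m ] ∑[ l < m ] inverted h k l

  exc≡excedances : ∀ (v : Vec (Fin n) n) → exc v ≡ excedances (values v)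
  exc≡excedances {n} v = trans (count-allFin (λ i → (suc (toℕ i) <? n) ×-dec (toℕ i <? values v i))) (sum-cong-≗ λ i →
    trans (𝟙-×-dec (suc (toℕ i) <? n) (toℕ i <? values v i)) (redundant i (toℕ i <? values v i)))
    where
    redundant : ∀ i (exceeds? : Dec (toℕ i < values v i)) → 𝟙 (suc (toℕ i) <? n) * 𝟙 exceeds? ≡ 𝟙 exceeds?
    redundant i (yes i<vᵢ) rewrite 𝟙-yes (suc (toℕ i) <? n) (≤-<-trans i<vᵢ (Fin.toℕ<n (lookup v i))) = refl
    redundant i (no _) = *-zeroʳ (𝟙 (suc (toℕ i) <? n))

  inv≡inversions : ∀ (v : Vec (Fin n) n) → inv v ≡ inversions (values v)
  inv≡inversions v = trans (count-allFin² (λ (k , l) → (toℕ k <? toℕ l) ×-dec (values v l <? values v k)))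
    (sum-cong-≗ λ k → sum-cong-≗ λ l → 𝟙-×-dec (toℕ k <? toℕ l) (values v l <? values v k))

  excedances-init : ∀ (h : Fin (suc n) → ℕ) → h (fromℕ n) ≤ n → excedances h ≡ excedances (h ∘ inject₁)
  excedances-init {n} h hₙ≤n = begin
    excedances h
      ≡⟨ sum-init-last (λ i → 𝟙 (toℕ i <? h i)) ⟩
    ∑[ i < n ] 𝟙 (toℕ (inject₁ i) <? h (inject₁ i)) + 𝟙 (toℕ (fromℕ n) <? h (fromℕ n))
      ≡⟨ cong₂ _+_ (sum-cong-≗ λ i → cong (λ x → 𝟙 (x <? h (inject₁ i))) (Fin.toℕ-inject₁ i))
                   (𝟙-no (toℕ (fromℕ n) <? h (fromℕ n)) (≤⇒≯ (subst (h (fromℕ n) ≤_) (sym (Fin.toℕ-fromℕ n)) hₙ≤n))) ⟩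
    excedances (h ∘ inject₁) + 0
      ≡⟨ +-identityʳ _ ⟩
    excedances (h ∘ inject₁) ∎
    where open ≡-Reasoning

  inversions-init : ∀ (h : Fin (suc n) → ℕ) →
                    inversions h ≡ inversions (h ∘ inject₁) + ∑[ k < n ] 𝟙 (h (fromℕ n) <? h (inject₁ k))
  inversions-init {n} h = begin
    inversions h
      ≡⟨ sum-init-last (λ k → sum (inverted h k)) ⟩
    ∑[ k < n ] sum (inverted h (inject₁ k)) + sum (inverted h (fromℕ n))
      ≡⟨ cong₂ _+_ (sum-cong-≗ λ k → sum-init-last (inverted h (inject₁ k))) (∑-zero from-top) ⟩
    ∑[ k < n ] (∑[ l < n ] inverted h (inject₁ k) (inject₁ l) + inverted h (inject₁ k) (fromℕ n)) + 0
      ≡⟨ +-identityʳ _ ⟩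
    ∑[ k < n ] (∑[ l < n ] inverted h (inject₁ k) (inject₁ l) + inverted h (inject₁ k) (fromℕ n))
      ≡⟨ ∑-distrib-+ (λ k → ∑[ l < n ] inverted h (inject₁ k) (inject₁ l)) (λ k → inverted h (inject₁ k) (fromℕ n)) ⟩
    ∑[ k < n ] ∑[ l < n ] inverted h (inject₁ k) (inject₁ l) + ∑[ k < n ] inverted h (inject₁ k) (fromℕ n)
      ≡⟨ cong₂ _+_ (sum-cong-≗ λ k → sum-cong-≗ λ l →
                      cong₂ (λ x y → 𝟙 (x <? y) * 𝟙 (h (inject₁ l) <? h (inject₁ k))) (Fin.toℕ-inject₁ k) (Fin.toℕ-inject₁ l))
                   (sum-cong-≗ to-top) ⟩
    inversions (h ∘ inject₁) + ∑[ k < n ] 𝟙 (h (fromℕ n) <? h (inject₁ k)) ∎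
    where
    open ≡-Reasoning
    from-top : ∀ l → inverted h (fromℕ n) l ≡ 0
    from-top l = cong (_* 𝟙 (h l <? h (fromℕ n))) (𝟙-no (toℕ (fromℕ n) <? toℕ l) (≤⇒≯ l≤n))
      where
      l≤n : toℕ l ≤ toℕ (fromℕ n)
      l≤n = subst (toℕ l ≤_) (sym (Fin.toℕ-fromℕ n)) (s≤s⁻¹ (Fin.toℕ<n l))
    to-top : ∀ k → inverted h (inject₁ k) (fromℕ n) ≡ 𝟙 (h (fromℕ n) <? h (inject₁ k))
    to-top k = trans (cong (_* 𝟙 (h (fromℕ n) <? h (inject₁ k))) (𝟙-yes (toℕ (inject₁ k) <? toℕ (fromℕ n)) k<n)) (+-identityʳ _)
      where
      k<n : toℕ (inject₁ k) < toℕ (fromℕ n)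
      k<n = subst₂ _<_ (sym (Fin.toℕ-inject₁ k)) (sym (Fin.toℕ-fromℕ n)) (Fin.toℕ<n k)

  inversions-cong : ∀ {f g : Fin m → ℕ} → f ≗ g → inversions f ≡ inversions g
  inversions-cong f≗g = sum-cong-≗ λ k → sum-cong-≗ λ l →
    cong₂ (λ x y → 𝟙 (toℕ k <? toℕ l) * 𝟙 (x <? y)) (f≗g l) (f≗g k)

  𝟙-<-irrefl : ∀ x → 𝟙 (x <? x) ≡ 0
  𝟙-<-irrefl x = 𝟙-no (x <? x) (n≮n x)

  𝟙-<-trichotomy : ∀ {x y} → x ≢ y → 𝟙 (x <? y) + 𝟙 (y <? x) ≡ 1
  𝟙-<-trichotomy {x} {y} x≢y with <-cmp x y
  ... | tri< x<y _ _ rewrite 𝟙-yes (x <? y) x<y | 𝟙-no (y <? x) (<-asym x<y) = refl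
  ... | tri≈ _ x≡y _ = contradiction x≡y x≢y
  ... | tri> _ _ y<x rewrite 𝟙-no (x <? y) (<-asym y<x) | 𝟙-yes (y <? x) y<x = refl

  inversionsAt : (Fin m → ℕ) → Fin m → ℕ
  inversionsAt {m} h a = ∑[ l < m ] (inverted h a l + inverted h l a)

  positionsAfter : Fin m → ℕ
  positionsAfter {m} a = ∑[ l < m ] 𝟙 (toℕ a <? toℕ l)

  valuesAbove : (Fin m → ℕ) → Fin m → ℕ
  valuesAbove {m} h a = ∑[ l < m ] 𝟙 (h a <? h l)

  largerAfter : (Fin m → ℕ) → Fin m → ℕ
  largerAfter {m} h a = ∑[ l < m ] (𝟙 (toℕ a <? toℕ l) * 𝟙 (h a <? h l))

  inversions-update : ∀ {f g : Fin m → ℕ} a → (∀ k → k ≢ a → f k ≡ g k) →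
                      inversions f + inversionsAt g a ≡ inversions g + inversionsAt f a
  inversions-update {f = f} {g} a f≡g = ∑²-update a agree (trans (diagonal f) (sym (diagonal g)))
    where
    agree : ∀ k l → k ≢ a → l ≢ a → inverted f k l ≡ inverted g k l
    agree k l k≢a l≢a = cong₂ (λ x y → 𝟙 (toℕ k <? toℕ l) * 𝟙 (x <? y)) (f≡g l l≢a) (f≡g k k≢a)
    diagonal : ∀ h → inverted h a a ≡ 0
    diagonal h = cong (_* 𝟙 (h a <? h a)) (𝟙-<-irrefl (toℕ a))

  inversionsAt-max : ∀ (h : Fin m → ℕ) a → (∀ l → l ≢ a → h l < h a) → inversionsAt h a ≡ positionsAfter a
  inversionsAt-max h a below = sum-cong-≗ pair
    where
    pair : ∀ l → inverted h a l + inverted h l a ≡ 𝟙 (toℕ a <? toℕ l)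
    pair l with l Fin.≟ a
    ... | yes refl rewrite 𝟙-<-irrefl (toℕ l) = refl
    ... | no l≢a rewrite 𝟙-yes (h l <? h a) (below l l≢a) | 𝟙-no (h a <? h l) (<-asym (below l l≢a)) =
      trans (cong₂ _+_ (*-identityʳ (𝟙 (toℕ a <? toℕ l))) (*-zeroʳ (𝟙 (toℕ l <? toℕ a)))) (+-identityʳ _)

  positionsAfter+valuesAbove : ∀ (h : Fin m → ℕ) → (∀ {k l} → h k ≡ h l → k ≡ l) → ∀ a →
    positionsAfter a + valuesAbove h a ≡ inversionsAt h a + 2 * largerAfter h a
  positionsAfter+valuesAbove {m} h h-inj a = begin
    positionsAfter a + valuesAbove h a
      ≡⟨ ∑-distrib-+ (λ l → 𝟙 (toℕ a <? toℕ l)) (λ l → 𝟙 (h a <? h l)) ⟨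
    ∑[ l < m ] (𝟙 (toℕ a <? toℕ l) + 𝟙 (h a <? h l))
      ≡⟨ sum-cong-≗ pair ⟩
    ∑[ l < m ] (inverted h a l + inverted h l a + 2 * (𝟙 (toℕ a <? toℕ l) * 𝟙 (h a <? h l)))
      ≡⟨ ∑-distrib-+ (λ l → inverted h a l + inverted h l a) (λ l → 2 * (𝟙 (toℕ a <? toℕ l) * 𝟙 (h a <? h l))) ⟩
    inversionsAt h a + ∑[ l < m ] (2 * (𝟙 (toℕ a <? toℕ l) * 𝟙 (h a <? h l)))
      ≡⟨ cong (inversionsAt h a +_) (*-distribˡ-sum 2 (λ l → 𝟙 (toℕ a <? toℕ l) * 𝟙 (h a <? h l))) ⟨
    inversionsAt h a + 2 * largerAfter h a ∎
    where
    open ≡-Reasoning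
    -- s, s′ indicate l > a and l < a; t, t′ indicate h l > h a and h l < h a.
    split : ∀ s s′ t t′ → s + s′ ≡ 1 → t + t′ ≡ 1 → s + t ≡ s * t′ + s′ * t + 2 * (s * t)
    split s s′ t t′ s+s′≡1 t+t′≡1 = begin
      s + t                             ≡⟨ cong₂ _+_ (sym (*-identityʳ s)) (sym (*-identityˡ t)) ⟩
      s * 1 + 1 * t                     ≡⟨ cong₂ (λ x y → s * x + y * t) (sym t+t′≡1) (sym s+s′≡1) ⟩
      s * (t + t′) + (s + s′) * t       ≡⟨ lemma s s′ t t′ ⟩
      s * t′ + s′ * t + 2 * (s * t)     ∎
      where
      lemma : ∀ s s′ t t′ → s * (t + t′) + (s + s′) * t ≡ s * t′ + s′ * t + 2 * (s * t)
      lemma = solve-∀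
    pair : ∀ l → 𝟙 (toℕ a <? toℕ l) + 𝟙 (h a <? h l) ≡
                 inverted h a l + inverted h l a + 2 * (𝟙 (toℕ a <? toℕ l) * 𝟙 (h a <? h l))
    pair l with l Fin.≟ a
    ... | yes refl rewrite 𝟙-<-irrefl (toℕ l) | 𝟙-<-irrefl (h l) = refl
    ... | no l≢a = split (𝟙 (toℕ a <? toℕ l)) (𝟙 (toℕ l <? toℕ a)) (𝟙 (h a <? h l)) (𝟙 (h l <? h a))
                         (𝟙-<-trichotomy (l≢a ∘ sym ∘ Fin.toℕ-injective)) (𝟙-<-trichotomy (l≢a ∘ sym ∘ h-inj))

  module _ (π : Vec (Fin n) n) where

    values-insertMax-at : ∀ o → values (insertMax π o) o ≡ n
    values-insertMax-at o = trans (cong toℕ (insertMax-at π o)) (Fin.toℕ-fromℕ n)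

    values-insertMax-inject₁ : ∀ {o} k → inject₁ k ≢ o → values (insertMax π o) (inject₁ k) ≡ values π k
    values-insertMax-inject₁ {o} k k≢o = begin
      toℕ (lookup (insertMax π o) (inject₁ k))  ≡⟨ cong toℕ (insertMax-other π o k≢o (Fin.fromℕ≢inject₁ ∘ sym)) ⟩
      toℕ (extend (lookup π) (inject₁ k))        ≡⟨ cong toℕ (extend-inject₁ (lookup π) k) ⟩
      toℕ (inject₁ (lookup π k))                 ≡⟨ Fin.toℕ-inject₁ (lookup π k) ⟩
      values π k                                 ∎
      where open ≡-Reasoning

    values-insertMax-fromℕ : ∀ a → values (insertMax π (inject₁ a)) (fromℕ n) ≡ values π a
    values-insertMax-fromℕ a = begin
      toℕ (lookup (insertMax π (inject₁ a)) (fromℕ n))  ≡⟨ cong toℕ (insertMax-fromℕ π (inject₁ a)) ⟩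
      toℕ (extend (lookup π) (inject₁ a))                ≡⟨ cong toℕ (extend-inject₁ (lookup π) a) ⟩
      toℕ (inject₁ (lookup π a))                         ≡⟨ Fin.toℕ-inject₁ (lookup π a) ⟩
      values π a                                         ∎
      where open ≡-Reasoning

    exc-insertMax : ∀ o → exc (insertMax π o) ≡ excedances (values (insertMax π o) ∘ inject₁)
    exc-insertMax o = trans (exc≡excedances (insertMax π o)) (excedances-init (values (insertMax π o)) (s≤s⁻¹ (Fin.toℕ<n _)))

    exc-insertMax-fromℕ : exc (insertMax π (fromℕ n)) ≡ exc π
    exc-insertMax-fromℕ = begin
      exc (insertMax π (fromℕ n))                          ≡⟨ exc-insertMax (fromℕ n) ⟩
      excedances (values (insertMax π (fromℕ n)) ∘ inject₁) ≡⟨ sum-cong-≗ (λ k → cong (𝟙 ∘ (toℕ k <?_)) (unmoved k)) ⟩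
      excedances (values π)                                ≡⟨ exc≡excedances π ⟨
      exc π                                                ∎
      where
      open ≡-Reasoning
      unmoved : ∀ k → values (insertMax π (fromℕ n)) (inject₁ k) ≡ values π k
      unmoved k = values-insertMax-inject₁ k (Fin.fromℕ≢inject₁ ∘ sym)

    exc-insertMax-inject₁ : ∀ a → exc (insertMax π (inject₁ a)) + 𝟙 (toℕ a <? values π a) ≡ suc (exc π)
    exc-insertMax-inject₁ a = begin
      exc σ + 𝟙 (toℕ a <? values π a)                 ≡⟨ cong (_+ 𝟙 (toℕ a <? values π a)) (exc-insertMax (inject₁ a)) ⟩
      excedances (values σ ∘ inject₁) + 𝟙 (toℕ a <? values π a)
        ≡⟨ ∑-update a (λ k k≢a → cong (𝟙 ∘ (toℕ k <?_)) (values-insertMax-inject₁ k (k≢a ∘ Fin.inject₁-injective))) ⟩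
      excedances (values π) + 𝟙 (toℕ a <? values σ (inject₁ a))
        ≡⟨ cong₂ _+_ (sym (exc≡excedances π)) (𝟙-yes (toℕ a <? values σ (inject₁ a)) a<n) ⟩
      exc π + 1                                       ≡⟨ +-comm (exc π) 1 ⟩
      suc (exc π)                                     ∎
      where
      open ≡-Reasoning
      σ : Vec (Fin (suc n)) (suc n)
      σ = insertMax π (inject₁ a)
      a<n : toℕ a < values σ (inject₁ a)
      a<n = subst (toℕ a <_) (sym (values-insertMax-at (inject₁ a))) (Fin.toℕ<n a)

    exc-insertMax-count : ∀ j → ∑[ a < n ] 𝟙 (exc (insertMax π (inject₁ a)) ≟ j) ≡
                                𝟙 (exc π ≟ j) * exc π + 𝟙 (suc (exc π) ≟ j) * nonExcedances (values π)
    exc-insertMax-count j = begin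
      ∑[ a < n ] 𝟙 (exc (insertMax π (inject₁ a)) ≟ j)
        ≡⟨ sum-cong-≗ (λ a → split (exceeds? a) (exc-insertMax-inject₁ a)) ⟩
      ∑[ a < n ] (𝟙 (e ≟ j) * 𝟙 (exceeds? a) + 𝟙 (suc e ≟ j) * 𝟙 (¬? (exceeds? a)))
        ≡⟨ ∑-distrib-+ (λ a → 𝟙 (e ≟ j) * 𝟙 (exceeds? a)) (λ a → 𝟙 (suc e ≟ j) * 𝟙 (¬? (exceeds? a))) ⟩
      ∑[ a < n ] (𝟙 (e ≟ j) * 𝟙 (exceeds? a)) + ∑[ a < n ] (𝟙 (suc e ≟ j) * 𝟙 (¬? (exceeds? a)))
        ≡⟨ cong₂ _+_ (*-distribˡ-sum (𝟙 (e ≟ j)) (𝟙 ∘ exceeds?))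
                     (*-distribˡ-sum (𝟙 (suc e ≟ j)) (𝟙 ∘ ¬? ∘ exceeds?)) ⟨
      𝟙 (e ≟ j) * excedances (values π) + 𝟙 (suc e ≟ j) * nonExcedances (values π)
        ≡⟨ cong (λ x → 𝟙 (e ≟ j) * x + 𝟙 (suc e ≟ j) * nonExcedances (values π)) (exc≡excedances π) ⟨
      𝟙 (e ≟ j) * e + 𝟙 (suc e ≟ j) * nonExcedances (values π) ∎
      where
      open ≡-Reasoning
      e : ℕ
      e = exc π
      exceeds? : ∀ a → Dec (toℕ a < values π a)
      exceeds? a = toℕ a <? values π a
      split : ∀ {p} {P : Set p} {x} (P? : Dec P) → x + 𝟙 P? ≡ suc e →
              𝟙 (x ≟ j) ≡ 𝟙 (e ≟ j) * 𝟙 P? + 𝟙 (suc e ≟ j) * 𝟙 (¬? P?)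
      split {x = x} (yes _) x+1≡ = begin
        𝟙 (x ≟ j)                                ≡⟨ cong (𝟙 ∘ (_≟ j)) (suc-injective (trans (+-comm 1 x) x+1≡)) ⟩
        𝟙 (e ≟ j)                                ≡⟨ lemma (𝟙 (e ≟ j)) (𝟙 (suc e ≟ j)) ⟩
        𝟙 (e ≟ j) * 1 + 𝟙 (suc e ≟ j) * 0        ∎
        where
        lemma : ∀ x y → x ≡ x * 1 + y * 0
        lemma = solve-∀
      split {x = x} (no _) x+0≡ = begin
        𝟙 (x ≟ j)                                ≡⟨ cong (𝟙 ∘ (_≟ j)) (trans (sym (+-identityʳ x)) x+0≡) ⟩
        𝟙 (suc e ≟ j)                            ≡⟨ lemma (𝟙 (e ≟ j)) (𝟙 (suc e ≟ j)) ⟩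
        𝟙 (e ≟ j) * 0 + 𝟙 (suc e ≟ j) * 1        ∎
        where
        lemma : ∀ x y → y ≡ x * 0 + y * 1
        lemma = solve-∀

    inv-insertMax-fromℕ : inv (insertMax π (fromℕ n)) ≡ inv π
    inv-insertMax-fromℕ = begin
      inv σ                                                             ≡⟨ inv≡inversions σ ⟩
      inversions (values σ)                                             ≡⟨ inversions-init (values σ) ⟩
      inversions (values σ ∘ inject₁) + ∑[ k < n ] 𝟙 (values σ (fromℕ n) <? values σ (inject₁ k))
        ≡⟨ cong₂ _+_ (inversions-cong unmoved)
                     (∑-zero (λ k → 𝟙-no (values σ (fromℕ n) <? values σ (inject₁ k)) (<-asym (below-top k)))) ⟩
      inversions (values π) + 0                                         ≡⟨ +-identityʳ _ ⟩
      inversions (values π)                                             ≡⟨ inv≡inversions π ⟨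
      inv π                                                             ∎
      where
      open ≡-Reasoning
      σ : Vec (Fin (suc n)) (suc n)
      σ = insertMax π (fromℕ n)
      unmoved : ∀ k → values σ (inject₁ k) ≡ values π k
      unmoved k = values-insertMax-inject₁ k (Fin.fromℕ≢inject₁ ∘ sym)
      below-top : ∀ k → values σ (inject₁ k) < values σ (fromℕ n)
      below-top k = subst₂ _<_ (sym (unmoved k)) (sym (values-insertMax-at (fromℕ n))) (Fin.toℕ<n (lookup π k))

    -- Off the last position, σ is π with the entry at a replaced by the maximum n, so their inversions
    -- differ only in pairs through a, and n is inverted exactly with the positions after a.
    inv-insertMax-inject₁ : IsPerm π → ∀ a → inv (insertMax π (inject₁ a)) ≡ inv π + suc (2 * largerAfter (values π) a)
    inv-insertMax-inject₁ π-perm a = +-cancelʳ-≡ (inversionsAt p a) _ _ (begin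
      inv σ + inversionsAt p a
        ≡⟨ cong (_+ inversionsAt p a) (trans (inv≡inversions σ) (inversions-init (values σ))) ⟩
      inversions g + ∑[ k < n ] 𝟙 (values σ (fromℕ n) <? g k) + inversionsAt p a
        ≡⟨ cong (λ t → inversions g + t + inversionsAt p a) last-column ⟩
      inversions g + suc (valuesAbove p a) + inversionsAt p a
        ≡⟨ lemma₁ (inversions g) (valuesAbove p a) (inversionsAt p a) ⟩
      inversions g + inversionsAt p a + suc (valuesAbove p a)
        ≡⟨ cong (_+ suc (valuesAbove p a)) (inversions-update a g≡p) ⟩
      inversions p + inversionsAt g a + suc (valuesAbove p a)
        ≡⟨ cong₂ (λ x y → x + y + suc (valuesAbove p a)) (sym (inv≡inversions π)) (inversionsAt-max g a below-top) ⟩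
      inv π + positionsAfter a + suc (valuesAbove p a)
        ≡⟨ lemma₂ (inv π) (positionsAfter a) (valuesAbove p a) ⟩
      inv π + suc (positionsAfter a + valuesAbove p a)
        ≡⟨ cong (λ t → inv π + suc t) (positionsAfter+valuesAbove p p-inj a) ⟩
      inv π + suc (inversionsAt p a + 2 * largerAfter p a)
        ≡⟨ lemma₃ (inv π) (inversionsAt p a) (2 * largerAfter p a) ⟩
      inv π + suc (2 * largerAfter p a) + inversionsAt p a ∎)
      where
      open ≡-Reasoning
      σ : Vec (Fin (suc n)) (suc n)
      σ = insertMax π (inject₁ a)
      p g : Fin n → ℕ
      p = values π
      g = values σ ∘ inject₁
      p-inj : ∀ {k l} → p k ≡ p l → k ≡ l
      p-inj pk≡pl = π-perm _ _ (Fin.toℕ-injective pk≡pl)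
      g≡p : ∀ k → k ≢ a → g k ≡ p k
      g≡p k k≢a = values-insertMax-inject₁ k (k≢a ∘ Fin.inject₁-injective)
      g-at : g a ≡ n
      g-at = values-insertMax-at (inject₁ a)
      below-top : ∀ k → k ≢ a → g k < g a
      below-top k k≢a = subst₂ _<_ (sym (g≡p k k≢a)) (sym g-at) (Fin.toℕ<n (lookup π k))
      last-column : ∑[ k < n ] 𝟙 (values σ (fromℕ n) <? g k) ≡ suc (valuesAbove p a)
      last-column = +-cancelʳ-≡ 0 _ _ (begin
        ∑[ k < n ] 𝟙 (values σ (fromℕ n) <? g k) + 0
          ≡⟨ cong₂ _+_ (sum-cong-≗ (λ k → cong (𝟙 ∘ (_<? g k)) (values-insertMax-fromℕ a))) (sym (𝟙-<-irrefl (p a))) ⟩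
        ∑[ k < n ] 𝟙 (p a <? g k) + 𝟙 (p a <? p a)
          ≡⟨ ∑-update a (λ k k≢a → cong (𝟙 ∘ (p a <?_)) (g≡p k k≢a)) ⟩
        valuesAbove p a + 𝟙 (p a <? g a)
          ≡⟨ cong (valuesAbove p a +_) (𝟙-yes (p a <? g a) (subst (p a <_) (sym g-at) (Fin.toℕ<n (lookup π a)))) ⟩
        valuesAbove p a + 1
          ≡⟨ trans (+-comm (valuesAbove p a) 1) (sym (+-identityʳ _)) ⟩
        suc (valuesAbove p a) + 0 ∎)
      lemma₁ : ∀ x v y → x + suc v + y ≡ x + y + suc v
      lemma₁ = solve-∀
      lemma₂ : ∀ x y v → x + y + suc v ≡ x + suc (y + v)
      lemma₂ = solve-∀
      lemma₃ : ∀ x y z → x + suc (y + z) ≡ x + suc z + y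
      lemma₃ = solve-∀

module ExcedanceCounts where

  open import Data.Nat.Base using (_%_)
  open import Data.Nat.Properties using (_≟_)
  open import Data.Nat.DivMod using ([m+kn]%n≡m%n)
  open import Data.Integer.Base using (ℤ; +_; 1ℤ; -1ℤ; _+_; _-_; _*_)
  open import Data.Integer.Properties using (pos-+; pos-*)
  open import Data.Integer.Tactic.RingSolver using (solve-∀)
  open import Data.Vec.Base using (Vec)
  open import Data.List.Base using (allFin; cartesianProductWith)
  open IntegerSums
  open PowerSeries using (shift; step)
  open InsertMax using (insertMax)
  open PermutationList using (perms-suc-↭; ∈-perms⇒IsPerm)
  open PermutationStatistics

  private variable
    n : ℕ

  -- Computed through m % 2 so that sign v below is definitionally -1^ inv v.
  -1^_ : ℕ → ℤ
  -1^ m = if does (m % 2 ≟ 0) then 1ℤ else -1ℤ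

  -1^-suc : ∀ m → -1^ suc m ≡ -1ℤ * -1^ m
  -1^-suc zero = refl
  -1^-suc (suc zero) = refl
  -1^-suc (suc (suc m)) = -1^-suc m

  -1^-periodic : ∀ m y → -1^ (m ℕ.+ 2 ℕ.* y) ≡ -1^ m
  -1^-periodic m y = cong (λ r → if does (r ≟ 0) then 1ℤ else -1ℤ)
    (trans (cong (_% 2) (cong (m ℕ.+_) (ℕP.*-comm 2 y))) ([m+kn]%n≡m%n m y 2))

  sign : Vec (Fin n) n → ℤ
  sign v = if does (even? v) then 1ℤ else -1ℤ

  module _ (π : Vec (Fin n) n) where

    sign-insertMax-fromℕ : sign (insertMax π (fromℕ n)) ≡ sign π
    sign-insertMax-fromℕ = cong -1^_ (inv-insertMax-fromℕ π)

    sign-insertMax-inject₁ : IsPerm π → ∀ a → sign (insertMax π (inject₁ a)) ≡ -1ℤ * sign π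
    sign-insertMax-inject₁ π-perm a = begin
      -1^ inv (insertMax π (inject₁ a))         ≡⟨ cong -1^_ (inv-insertMax-inject₁ π π-perm a) ⟩
      -1^ (inv π ℕ.+ suc (2 ℕ.* Y))             ≡⟨ cong -1^_ (ℕP.+-suc (inv π) (2 ℕ.* Y)) ⟩
      -1^ suc (inv π ℕ.+ 2 ℕ.* Y)               ≡⟨ -1^-suc (inv π ℕ.+ 2 ℕ.* Y) ⟩
      -1ℤ * -1^ (inv π ℕ.+ 2 ℕ.* Y)             ≡⟨ cong (-1ℤ *_) (-1^-periodic (inv π) Y) ⟩
      -1ℤ * sign π                              ∎
      where
      open ≡-Reasoning
      Y : ℕ
      Y = largerAfter (values π) a

  weightedExcPoly : (∀ {n} → Vec (Fin n) n → ℤ) → ℕ → Series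
  weightedExcPoly χ n j = ∑[ π ∈ perms n ] (+ 𝟙 (exc π ≟ j) * χ π)

  ∑-perms-suc : ∀ n (f : Vec (Fin (suc n)) (suc n) → ℤ) →
                ∑ˡ (perms (suc n)) f ≡ ∑[ π ∈ perms n ] ∑ᶠ (f ∘ insertMax π)
  ∑-perms-suc n f = begin
    ∑ˡ (perms (suc n)) f
      ≡⟨ ∑ˡ-↭ f (perms-suc-↭ n) ⟩
    ∑ˡ (cartesianProductWith insertMax (perms n) (allFin (suc n))) f
      ≡⟨ ∑ˡ-cartesianProductWith insertMax (perms n) (allFin (suc n)) f ⟩
    ∑[ π ∈ perms n ] ∑[ o ∈ allFin (suc n) ] f (insertMax π o)
      ≡⟨ ∑ˡ-cong (perms n) (λ {π} _ → ∑ˡ-tabulate id (f ∘ insertMax π)) ⟩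
    ∑[ π ∈ perms n ] ∑ᶠ (f ∘ insertMax π) ∎
    where open ≡-Reasoning

  weightedExcPoly-shift : ∀ (χ : ∀ {m} → Vec (Fin m) m → ℤ) n j →
                          ∑[ π ∈ perms n ] (+ 𝟙 (suc (exc π) ≟ j) * χ π) ≡ shift (weightedExcPoly χ n) j
  weightedExcPoly-shift χ n zero = ∑ˡ-zero (perms n)
  weightedExcPoly-shift χ n (suc j) = refl

  𝟙-≟-subst : ∀ x y (f : ℕ → ℤ) → + 𝟙 (x ≟ y) * f x ≡ + 𝟙 (x ≟ y) * f y
  𝟙-≟-subst x y f = subst-under (x ≟ y)
    where
    subst-under : ∀ {x y} (x≟y : Dec (x ≡ y)) → + 𝟙 x≟y * f x ≡ + 𝟙 x≟y * f y
    subst-under (yes refl) = refl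
    subst-under (no _) = refl

  module _ (χ : ∀ {n} → Vec (Fin n) n → ℤ) (c : ℤ)
           (χ-fromℕ : ∀ {n} (π : Vec (Fin n) n) → χ (insertMax π (fromℕ n)) ≡ χ π)
           (χ-inject₁ : ∀ {n} (π : Vec (Fin n) n) → IsPerm π → ∀ a → χ (insertMax π (inject₁ a)) ≡ c * χ π) where

    ∑-insertMax : ∀ (π : Vec (Fin n) n) → IsPerm π → ∀ j →
      ∑ᶠ (λ o → + 𝟙 (exc (insertMax π o) ≟ j) * χ (insertMax π o))
        ≡ (1ℤ + c * + j) * (+ 𝟙 (exc π ≟ j) * χ π) + c * (+ suc n - + j) * (+ 𝟙 (suc (exc π) ≟ j) * χ π)
    ∑-insertMax {n} π π-perm j = begin
      ∑ᶠ w                                                        ≡⟨ ∑ᶠ-init-last w ⟩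
      ∑ᶠ (w ∘ inject₁) + w (fromℕ n)                               ≡⟨ cong₂ _+_ (∑ᶠ-cong moved) fixed ⟩
      ∑ᶠ (λ a → + hits a * (c * χ π)) + δ₀ * χ π                    ≡⟨ cong (_+ δ₀ * χ π) (*-distribʳ-∑ᶠ (c * χ π) (+_ ∘ hits)) ⟨
      ∑ᶠ (+_ ∘ hits) * (c * χ π) + δ₀ * χ π                         ≡⟨ cong (λ t → t * (c * χ π) + δ₀ * χ π) count ⟩
      (δ₀ * + j + δ₁ * (+ suc n - + j)) * (c * χ π) + δ₀ * χ π      ≡⟨ lemma δ₀ δ₁ (+ j) (+ suc n) c (χ π) ⟩
      (1ℤ + c * + j) * (δ₀ * χ π) + c * (+ suc n - + j) * (δ₁ * χ π) ∎
      where
      open ≡-Reasoning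
      e m : ℕ
      e = exc π
      m = nonExcedances (values π)
      δ₀ δ₁ : ℤ
      δ₀ = + 𝟙 (e ≟ j)
      δ₁ = + 𝟙 (suc e ≟ j)
      w : Fin (suc n) → ℤ
      w o = + 𝟙 (exc (insertMax π o) ≟ j) * χ (insertMax π o)
      hits : Fin n → ℕ
      hits a = 𝟙 (exc (insertMax π (inject₁ a)) ≟ j)
      moved : ∀ a → w (inject₁ a) ≡ + hits a * (c * χ π)
      moved a = cong (+ hits a *_) (χ-inject₁ π π-perm a)
      fixed : w (fromℕ n) ≡ δ₀ * χ π
      fixed = cong₂ (λ e x → + 𝟙 (e ≟ j) * x) (exc-insertMax-fromℕ π) (χ-fromℕ π)
      e+m≡n : e ℕ.+ m ≡ n
      e+m≡n = trans (cong (ℕ._+ m) (exc≡excedances π)) (excedances+nonExcedances (values π))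
      m≡n-e : + m ≡ + suc n - + suc e
      m≡n-e = begin
        + m                             ≡⟨ shuffle (+ e) (+ m) ⟩
        1ℤ + (+ e + + m) - (1ℤ + + e)   ≡⟨ cong (λ t → 1ℤ + t - (1ℤ + + e)) (trans (sym (pos-+ e m)) (cong +_ e+m≡n)) ⟩
        + suc n - + suc e               ∎
        where
        shuffle : ∀ E M → M ≡ 1ℤ + (E + M) - (1ℤ + E)
        shuffle = solve-∀
      count : ∑ᶠ (+_ ∘ hits) ≡ δ₀ * + j + δ₁ * (+ suc n - + j)
      count = begin
        ∑ᶠ (+_ ∘ hits)                                ≡⟨ pos-sum hits ⟨
        + sum hits                                    ≡⟨ cong +_ (exc-insertMax-count π j) ⟩
        + (𝟙 (e ≟ j) ℕ.* e ℕ.+ 𝟙 (suc e ≟ j) ℕ.* m)   ≡⟨ pos-+ (𝟙 (e ≟ j) ℕ.* e) (𝟙 (suc e ≟ j) ℕ.* m) ⟩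
        + (𝟙 (e ≟ j) ℕ.* e) + + (𝟙 (suc e ≟ j) ℕ.* m) ≡⟨ cong₂ _+_ (pos-* (𝟙 (e ≟ j)) e) (pos-* (𝟙 (suc e ≟ j)) m) ⟩
        δ₀ * + e + δ₁ * + m                           ≡⟨ cong₂ _+_ (𝟙-≟-subst e j (λ x → + x)) (cong (δ₁ *_) m≡n-e) ⟩
        δ₀ * + j + δ₁ * (+ suc n - + suc e)           ≡⟨ cong (λ t → δ₀ * + j + t) (𝟙-≟-subst (suc e) j (λ x → + suc n - + x)) ⟩
        δ₀ * + j + δ₁ * (+ suc n - + j)               ∎
      lemma : ∀ δ₀ δ₁ J N c x →
              (δ₀ * J + δ₁ * (N - J)) * (c * x) + δ₀ * x ≡ (1ℤ + c * J) * (δ₀ * x) + c * (N - J) * (δ₁ * x)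
      lemma = solve-∀

    weightedExcPoly-suc : ∀ n → weightedExcPoly χ (suc n) ≗ step c n (weightedExcPoly χ n)
    weightedExcPoly-suc n j = begin
      ∑[ σ ∈ perms (suc n) ] (+ 𝟙 (exc σ ≟ j) * χ σ)
        ≡⟨ ∑-perms-suc n (λ σ → + 𝟙 (exc σ ≟ j) * χ σ) ⟩
      ∑[ π ∈ perms n ] ∑ᶠ (λ o → + 𝟙 (exc (insertMax π o) ≟ j) * χ (insertMax π o))
        ≡⟨ ∑ˡ-cong (perms n) (λ {π} π∈ → ∑-insertMax π (∈-perms⇒IsPerm {v = π} π∈) j) ⟩
      ∑[ π ∈ perms n ] (a * A π + b * B π)
        ≡⟨ ∑ˡ-distrib-+ (perms n) (λ π → a * A π) (λ π → b * B π) ⟩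
      ∑ˡ (perms n) (λ π → a * A π) + ∑ˡ (perms n) (λ π → b * B π)
        ≡⟨ cong₂ _+_ (*-distribˡ-∑ˡ a (perms n) A) (*-distribˡ-∑ˡ b (perms n) B) ⟨
      a * ∑ˡ (perms n) A + b * ∑ˡ (perms n) B
        ≡⟨ cong (λ t → a * ∑ˡ (perms n) A + b * t) (weightedExcPoly-shift χ n j) ⟩
      step c n (weightedExcPoly χ n) j ∎
      where
      open ≡-Reasoning
      a b : ℤ
      a = 1ℤ + c * + j
      b = c * (+ suc n - + j)
      A B : Vec (Fin n) n → ℤ
      A π = + 𝟙 (exc π ≟ j) * χ π
      B π = + 𝟙 (suc (exc π) ≟ j) * χ π

module Parity where

  open import Data.Nat.Base using (_+_; _*_; _^_)
  open import Data.Nat.Properties using (*-identityʳ; +-identityʳ)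
  open import Data.Nat.Tactic.RingSolver using (solve-∀)
  open import Data.Product using (Σ; _,_)

  square≡+2* : ∀ a → Σ ℕ λ q → a * a ≡ a + 2 * q
  square≡+2* zero = 0 , refl
  square≡+2* (suc b) with square≡+2* b
  ... | q , b²≡ = q + b , (begin
    suc b * suc b         ≡⟨ lemma₁ b ⟩
    b * b + (2 * b + 1)   ≡⟨ cong (_+ (2 * b + 1)) b²≡ ⟩
    b + 2 * q + (2 * b + 1) ≡⟨ lemma₂ b q ⟩
    suc b + 2 * (q + b)   ∎)
    where
    open ≡-Reasoning
    lemma₁ : ∀ b → suc b * suc b ≡ b * b + (2 * b + 1)
    lemma₁ = solve-∀
    lemma₂ : ∀ b q → b + 2 * q + (2 * b + 1) ≡ suc b + 2 * (q + b)
    lemma₂ = solve-∀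

  power≡+2* : ∀ a m → Σ ℕ λ q → a ^ suc m ≡ a + 2 * q
  power≡+2* a zero = 0 , trans (*-identityʳ a) (sym (+-identityʳ a))
  power≡+2* a (suc m) with power≡+2* a m | square≡+2* a
  ... | q , aᵐ⁺¹≡ | t , a²≡ = t + a * q , (begin
    a * a ^ suc m         ≡⟨ cong (a *_) aᵐ⁺¹≡ ⟩
    a * (a + 2 * q)       ≡⟨ lemma₁ a q ⟩
    a * a + 2 * (a * q)   ≡⟨ cong (_+ 2 * (a * q)) a²≡ ⟩
    a + 2 * t + 2 * (a * q) ≡⟨ lemma₂ a t q ⟩
    a + 2 * (t + a * q)   ∎)
    where
    open ≡-Reasoning
    lemma₁ : ∀ a q → a * (a + 2 * q) ≡ a * a + 2 * (a * q)
    lemma₁ = solve-∀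
    lemma₂ : ∀ a t q → a + 2 * t + 2 * (a * q) ≡ a + 2 * (t + a * q)
    lemma₂ = solve-∀

module RightHandSides where

  open import Data.Nat.Base using (_^_)
  open import Data.Nat.DivMod using (m*n/n≡m)
  open import Data.Nat.Tactic.RingSolver as ℕ-Solver using ()
  open import Data.Integer.Base using (+_; 1ℤ; -1ℤ; _+_; _*_)
  open import Data.Integer.Properties using (pos-+; pos-*)
  open import Data.Integer.Tactic.RingSolver using (solve-∀)
  open import Data.Product using (_,_)
  open Parity using (power≡+2*)

  double-RHS⁺ : ∀ m k → + 2 * RHS⁺ (suc m) k ≡ + (suc k ^ suc m) + 1ℤ * + suc k
  double-RHS⁺ m k with power≡+2* (suc k) m
  ... | q , aᵐ≡ = begin
    + 2 * + ((suc k ^ suc m ℕ.+ suc k) ℕ./ 2)  ≡⟨ cong (λ x → + 2 * + x) half ⟩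
    + 2 * + (suc k ℕ.+ q)                       ≡⟨ cong (+ 2 *_) (pos-+ (suc k) q) ⟩
    + 2 * (+ suc k + + q)                       ≡⟨ lemma (+ suc k) (+ q) ⟩
    + suc k + + 2 * + q + 1ℤ * + suc k          ≡⟨ cong (λ x → + suc k + x + 1ℤ * + suc k) (pos-* 2 q) ⟨
    + suc k + + (2 ℕ.* q) + 1ℤ * + suc k        ≡⟨ cong (_+ 1ℤ * + suc k) (trans (cong +_ aᵐ≡) (pos-+ (suc k) (2 ℕ.* q))) ⟨
    + (suc k ^ suc m) + 1ℤ * + suc k            ∎
    where
    open ≡-Reasoning
    half : (suc k ^ suc m ℕ.+ suc k) ℕ./ 2 ≡ suc k ℕ.+ q
    half = trans (cong (λ x → (x ℕ.+ suc k) ℕ./ 2) aᵐ≡)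
                 (trans (cong (ℕ._/ 2) (rearrange (suc k) q)) (m*n/n≡m (suc k ℕ.+ q) 2))
      where
      rearrange : ∀ a q → a ℕ.+ 2 ℕ.* q ℕ.+ a ≡ (a ℕ.+ q) ℕ.* 2
      rearrange = ℕ-Solver.solve-∀
    lemma : ∀ a q → + 2 * (a + q) ≡ a + + 2 * q + 1ℤ * a
    lemma = solve-∀

  double-RHS⁻ : ∀ m k → + 2 * RHS⁻ (suc m) k ≡ + (suc k ^ suc m) + -1ℤ * + suc k
  double-RHS⁻ m k with power≡+2* (suc k) m
  ... | q , aᵐ≡ = begin
    + 2 * + ((suc k ^ suc m ℕ.∸ suc k) ℕ./ 2)  ≡⟨ cong (λ x → + 2 * + x) half ⟩
    + 2 * + q                                   ≡⟨ lemma (+ suc k) (+ 2 * + q) ⟩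
    + suc k + + 2 * + q + -1ℤ * + suc k         ≡⟨ cong (λ x → + suc k + x + -1ℤ * + suc k) (pos-* 2 q) ⟨
    + suc k + + (2 ℕ.* q) + -1ℤ * + suc k       ≡⟨ cong (_+ -1ℤ * + suc k) (trans (cong +_ aᵐ≡) (pos-+ (suc k) (2 ℕ.* q))) ⟨
    + (suc k ^ suc m) + -1ℤ * + suc k           ∎
    where
    open ≡-Reasoning
    half : (suc k ^ suc m ℕ.∸ suc k) ℕ./ 2 ≡ q
    half = trans (cong (λ x → (x ℕ.∸ suc k) ℕ./ 2) aᵐ≡)
                 (trans (cong (ℕ._/ 2) (trans (ℕP.m+n∸m≡n (suc k) (2 ℕ.* q)) (ℕP.*-comm 2 q))) (m*n/n≡m q 2))
    lemma : ∀ a x → x ≡ a + x + -1ℤ * a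
    lemma = solve-∀

open import Data.Nat.Base using (_≤_; _^_)
open import Data.Nat.Properties using (_≟_)
open import Data.Integer.Base using (ℤ; +_; 1ℤ; -1ℤ; _+_; _*_)
import Data.Integer.Properties as ℤ
open import Data.Integer.Tactic.RingSolver using (solve-∀)
open import Data.Vec.Base using (Vec)
open import Data.List.Base using (filter; length)
open import Data.Product using (_×_; _,_)
open import Relation.Unary using (Decidable)
open import Relation.Nullary.Decidable using (¬?)
open IntegerSums using (∑ˡ; length-filter; ∑ˡ-filter; ∑ˡ-cong; ∑ˡ-distrib-+; *-distribˡ-∑ˡ)
open PowerSeries
open ExcedanceCounts
open RightHandSides

one : ∀ {n} → Vec (Fin n) n → ℤ
one _ = 1ℤ

weightedExcPoly-one : ∀ n → weightedExcPoly one n ≗ eulerian n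
weightedExcPoly-one zero zero = refl
weightedExcPoly-one zero (suc j) = refl
weightedExcPoly-one (suc n) j = begin
  weightedExcPoly one (suc n) j        ≡⟨ weightedExcPoly-suc one 1ℤ (λ _ → refl) (λ _ _ _ → refl) n j ⟩
  step 1ℤ n (weightedExcPoly one n) j  ≡⟨ step-cong 1ℤ n (weightedExcPoly-one n) j ⟩
  step 1ℤ n (eulerian n) j             ≡⟨ eulerian-suc n j ⟨
  eulerian (suc n) j                   ∎
  where open ≡-Reasoning

weightedExcPoly-sign : ∀ m → weightedExcPoly sign (suc m) ≗ signedEulerian (suc m)
weightedExcPoly-sign zero j = trans (base j) (sym (signedEulerian-one j))
  where
  base : weightedExcPoly sign 1 ≗ oneS
  base zero = refl
  base (suc j) = refl
weightedExcPoly-sign (suc m) j = begin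
  weightedExcPoly sign (suc (suc m)) j
    ≡⟨ weightedExcPoly-suc sign -1ℤ sign-insertMax-fromℕ sign-insertMax-inject₁ (suc m) j ⟩
  step -1ℤ (suc m) (weightedExcPoly sign (suc m)) j
    ≡⟨ step-cong -1ℤ (suc m) (weightedExcPoly-sign m) j ⟩
  step -1ℤ (suc m) (signedEulerian (suc m)) j
    ≡⟨ signedEulerian-suc m j ⟨
  signedEulerian (suc (suc m)) j ∎
  where open ≡-Reasoning

excPoly-doubled : ∀ n {q} {Q : Vec (Fin n) n → Set q} (Q? : Decidable Q) (ε : ℤ) →
                  (∀ π → + 2 * + 𝟙 (Q? π) ≡ 1ℤ + ε * sign π) → ∀ j →
                  + 2 * excPoly (filter Q? (perms n)) j ≡ weightedExcPoly one n j + ε * weightedExcPoly sign n j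
excPoly-doubled n Q? ε 2𝟙Q≡ j = begin
  + 2 * + length (filter (λ v → exc v ≟ j) (filter Q? (perms n)))
    ≡⟨ cong (+ 2 *_) (length-filter (λ v → exc v ≟ j) (filter Q? (perms n))) ⟩
  + 2 * ∑ˡ (filter Q? (perms n)) (λ π → + 𝟙 (exc π ≟ j))
    ≡⟨ cong (+ 2 *_) (∑ˡ-filter Q? (perms n) (λ π → + 𝟙 (exc π ≟ j))) ⟩
  + 2 * ∑ˡ (perms n) (λ π → + 𝟙 (Q? π) * + 𝟙 (exc π ≟ j))
    ≡⟨ *-distribˡ-∑ˡ (+ 2) (perms n) (λ π → + 𝟙 (Q? π) * + 𝟙 (exc π ≟ j)) ⟩
  ∑ˡ (perms n) (λ π → + 2 * (+ 𝟙 (Q? π) * + 𝟙 (exc π ≟ j)))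
    ≡⟨ ∑ˡ-cong (perms n) (λ {π} _ → split (+ 𝟙 (Q? π)) (+ 𝟙 (exc π ≟ j)) (sign π) (2𝟙Q≡ π)) ⟩
  ∑ˡ (perms n) (λ π → + 𝟙 (exc π ≟ j) * 1ℤ + ε * (+ 𝟙 (exc π ≟ j) * sign π))
    ≡⟨ ∑ˡ-distrib-+ (perms n) (λ π → + 𝟙 (exc π ≟ j) * 1ℤ) (λ π → ε * (+ 𝟙 (exc π ≟ j) * sign π)) ⟩
  weightedExcPoly one n j + ∑ˡ (perms n) (λ π → ε * (+ 𝟙 (exc π ≟ j) * sign π))
    ≡⟨ cong (λ t → weightedExcPoly one n j + t) (*-distribˡ-∑ˡ ε (perms n) (λ π → + 𝟙 (exc π ≟ j) * sign π)) ⟨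
  weightedExcPoly one n j + ε * weightedExcPoly sign n j ∎
  where
  open ≡-Reasoning
  split : ∀ q e s → + 2 * q ≡ 1ℤ + ε * s → + 2 * (q * e) ≡ e * 1ℤ + ε * (e * s)
  split q e s 2q≡ = begin
    + 2 * (q * e)          ≡⟨ ℤ.*-assoc (+ 2) q e ⟨
    + 2 * q * e            ≡⟨ cong (_* e) 2q≡ ⟩
    (1ℤ + ε * s) * e       ≡⟨ lemma ε s e ⟩
    e * 1ℤ + ε * (e * s)   ∎
    where
    lemma : ∀ ε s e → (1ℤ + ε * s) * e ≡ e * 1ℤ + ε * (e * s)
    lemma = solve-∀

excPoly-/[1-t]^ : ∀ m {q} {Q : Vec (Fin (suc m)) (suc m) → Set q} (Q? : Decidable Q) (ε : ℤ) →
  (∀ π → + 2 * + 𝟙 (Q? π) ≡ 1ℤ + ε * sign π) →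
  (S : Series) → (∀ k → + 2 * S k ≡ + (suc k ^ suc m) + ε * + suc k) →
  S ≐ excPoly (filter Q? (perms (suc m))) /[1-t]^ suc (suc m)
excPoly-/[1-t]^ m Q? ε 2𝟙Q≡ S 2S≡ j = ℤ.*-cancelˡ-≡ (+ 2) _ _ (begin
  + 2 * excPoly (filter Q? (perms (suc m))) j
    ≡⟨ excPoly-doubled (suc m) Q? ε 2𝟙Q≡ j ⟩
  weightedExcPoly one (suc m) j + ε * weightedExcPoly sign (suc m) j
    ≡⟨ cong₂ (λ x y → x + ε * y) (weightedExcPoly-one (suc m) j) (weightedExcPoly-sign m j) ⟩
  Δ^ (suc (suc m)) (powers (suc m)) j + ε * Δ^ (suc (suc m)) (λ k → + suc k) j
    ≡⟨ Δ^-+* (suc (suc m)) ε (powers (suc m)) (λ k → + suc k) j ⟨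
  Δ^ (suc (suc m)) (λ k → powers (suc m) k + ε * + suc k) j
    ≡⟨ Δ^-cong (suc (suc m)) (λ k → sym (2S≡ k)) j ⟩
  Δ^ (suc (suc m)) (λ k → + 2 * S k) j
    ≡⟨ Δ^-* (suc (suc m)) (+ 2) S j ⟩
  + 2 * Δ^ (suc (suc m)) S j
    ≡⟨ cong (+ 2 *_) ([1-t]^-⊛ (suc (suc m)) S j) ⟨
  + 2 * ((oneMinusT ^S (suc (suc m))) ⊛ S) j ∎)
  where open ≡-Reasoning

theorem1p7 : (n : ℕ) → 1 ≤ n → (RHS⁺ n ≐ AE⁺ n /[1-t]^ suc n) × (RHS⁻ n ≐ AE⁻ n /[1-t]^ suc n)
theorem1p7 (suc m) _ =
  excPoly-/[1-t]^ m even? 1ℤ (λ π → 𝟙-sign (even? π)) (RHS⁺ (suc m)) (double-RHS⁺ m) ,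
  excPoly-/[1-t]^ m (¬? ∘ even?) -1ℤ (λ π → 𝟙¬-sign (even? π)) (RHS⁻ (suc m)) (double-RHS⁻ m)
  where
  𝟙-sign : ∀ {p} {P : Set p} (P? : Dec P) → + 2 * + 𝟙 P? ≡ 1ℤ + 1ℤ * (if does P? then 1ℤ else -1ℤ)
  𝟙-sign (yes _) = refl
  𝟙-sign (no _) = refl
  𝟙¬-sign : ∀ {p} {P : Set p} (P? : Dec P) → + 2 * + 𝟙 (¬? P?) ≡ 1ℤ + -1ℤ * (if does P? then 1ℤ else -1ℤ)
  𝟙¬-sign (yes _) = refl
  𝟙¬-sign (no _) = refl
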